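{- Let $K\ge1$, $n\ge1$, and let $R\subseteq(T^K_\Sigma)^n$ be an automatic relation. Then the relation $C(R)=\{(C(t_1),\dots,C(t_n)):(t_1,\dots,t_n)\in R\}\subseteq(\widehat\Sigma^\star)^n$ is automatic (i.e. $\otimes C(R)$ is a regular word language), and a finite automaton recognising $\otimes C(R)$ can be computed from a tree automaton recognising $\otimes R$.
   Context: A tree domain is a non-empty finite prefix-closed $D\subseteq\{0,1\}^\star$ with $u0\in D$ iff $u1\in D$ for all $u\in D$; a tree over the finite alphabet $\Sigma$ is a map $t\colon D\to\Sigma$ with $\operatorname{dom}(t)=D$. Thickness is $\max_\ell|\operatorname{dom}(t)\cap\{0,1\}^\ell|$, height $h(t)=\max\{|u|:u\in\operatorname{dom}(t)\}$, $T^K_\Sigma$ is the set of trees of thickness $\le K$. Tree convolution $\otimes(t_1,\dots,t_n)$ is the tree on $\bigcup_i\operatorname{dom}(t_i)$ labelled at $u$ by the tuple of $t_i(u)$ (or a padding symbol $\Box$ where undefined); a relation of trees is automatic if its set of convolutions is recognised by a (deterministic bottom-up) tree automaton. Word convolution $\otimes(w_1,\dots,w_n)$ over alphabet $\Gamma$ is the word over $(\Gamma\cup\{\Box\})^n$ whose $j$-th letter is the tuple of $j$-th letters, shorter words padded at the end with $\Box$; a word relation is automatic if its set of convolutions is regular. Encoding: let $\$$ be a new symbol and $\widehat\Sigma=\Sigma\times\{0,1\}\cup\{\$\}$. For $t\in T^K_\Sigma$ with $m=h(t)$, $C(t)=\sigma_0\cdots\sigma_m$ where, with $u_{\ell,1},\dots,u_{\ell,s_\ell}$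 the lexicographic (with $0<1$) enumeration of $\operatorname{dom}(t)\cap\{0,1\}^\ell$, $c_{\ell,r}=1$ if $u_{\ell,r}$ has children and $0$ otherwise, $\sigma_\ell=\langle t(u_{\ell,1}),c_{\ell,1}\rangle\cdots\langle t(u_{\ell,s_\ell}),c_{\ell,s_\ell}\rangle\$^{K-s_\ell}$. -}

module Defs where

open import Data.Nat using (ℕ; zero; suc; _∸_; _≤_; _⊔_)
open import Data.Bool using (Bool; true; false)
open import Data.Fin using (Fin)
open import Data.Maybe using (Maybe; just; nothing)
open import Data.List using (List; []; _∷_; _++_; length; replicate; map; concatMap; upTo)
open import Data.Vec using (Vec; []; _∷_)
import Data.Vec as Vec
open import Data.Product using (Σ; _×_; _,_; ∃)
open import Relation.Binary.PropositionalEquality using (_≡_)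
open import Function.Bundles using (_⇔_)

-- Trees.  A tree domain (non-empty, finite, prefix closed, u0 ∈ D iff
-- u1 ∈ D) together with a labelling is exactly a finite full binary
-- tree: every node is a leaf or has both children 0 and 1.

data Tree (A : Set) : Set where
  leaf : A → Tree A
  node : A → Tree A → Tree A → Tree A

mapT : {A B : Set} → (A → B) → Tree A → Tree B
mapT f (leaf a)     = leaf (f a)
mapT f (node a l r) = node (f a) (mapT f l) (mapT f r)

levelCount : {A : Set} → Tree A → ℕ → ℕ
levelCount t            zero    = 1
levelCount (leaf a)     (suc ℓ) = 0
levelCount (node a l r) (suc ℓ) = levelCount l ℓ Data.Nat.+ levelCount r ℓ

ThicknessAtMost : {A : Set} → ℕ → Tree A → Set
ThicknessAtMost K t = ∀ ℓ → levelCount t ℓ ≤ K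

height : {A : Set} → Tree A → ℕ
height (leaf a)     = 0
height (node a l r) = suc (height l ⊔ height r)

-- Tree convolution of n ≥ 1 trees (written with n = suc m).
-- Padding symbol □ is `nothing`.

padHead : {A : Set} {m : ℕ} → Tree (Vec (Maybe A) m) → Tree (Vec (Maybe A) (suc m))
padHead = mapT (nothing ∷_)

padTail : {A : Set} {m : ℕ} → Tree A → Tree (Vec (Maybe A) (suc m))
padTail {m = m} = mapT (λ a → just a ∷ Vec.replicate m nothing)

consT : {A : Set} {m : ℕ} → Tree A → Tree (Vec (Maybe A) m) → Tree (Vec (Maybe A) (suc m))
consT (leaf a)     (leaf v)       = leaf (just a ∷ v)
consT (leaf a)     (node v l r)   = node (just a ∷ v) (padHead l) (padHead r)
consT (node a l r) (leaf v)       = node (just a ∷ v) (padTail l) (padTail r)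
consT (node a l r) (node v l' r') = node (just a ∷ v) (consT l l') (consT r r')

convT : {A : Set} {m : ℕ} → Vec (Tree A) (suc m) → Tree (Vec (Maybe A) (suc m))
convT (t ∷ [])     = mapT (λ a → just a ∷ []) t
convT (t ∷ u ∷ ts) = consT t (convT (u ∷ ts))

consW : {A : Set} {n : ℕ} → List A → List (Vec (Maybe A) n) → List (Vec (Maybe A) (suc n))
consW         []      vs       = map (nothing ∷_) vs
consW {n = n} (x ∷ w) []       = (just x ∷ Vec.replicate n nothing) ∷ consW w []
consW         (x ∷ w) (v ∷ vs) = (just x ∷ v) ∷ consW w vs

convW : {A : Set} {n : ℕ} → Vec (List A) n → List (Vec (Maybe A) n)
convW []       = []
convW (w ∷ ws) = consW w (convW ws)

record TreeAut (Γ : Set) : Set where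
  field
    states  : ℕ
    δleaf   : Γ → Fin states
    δnode   : Γ → Fin states → Fin states → Fin states
    final   : Fin states → Bool

runT : {Γ : Set} (𝒜 : TreeAut Γ) → Tree Γ → Fin (TreeAut.states 𝒜)
runT 𝒜 (leaf a)     = TreeAut.δleaf 𝒜 a
runT 𝒜 (node a l r) = TreeAut.δnode 𝒜 a (runT 𝒜 l) (runT 𝒜 r)

AcceptsT : {Γ : Set} → TreeAut Γ → Tree Γ → Set
AcceptsT 𝒜 t = TreeAut.final 𝒜 (runT 𝒜 t) ≡ true

record DFA (Γ : Set) : Set where
  field
    states  : ℕ
    init    : Fin states
    δ       : Fin states → Γ → Fin states
    final   : Fin states → Bool

runW : {Γ : Set} (𝒟 : DFA Γ) → Fin (DFA.states 𝒟) → List Γ → Fin (DFA.states 𝒟)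
runW 𝒟 q []      = q
runW 𝒟 q (x ∷ w) = runW 𝒟 (DFA.δ 𝒟 q x) w

AcceptsW : {Γ : Set} → DFA Γ → List Γ → Set
AcceptsW 𝒟 w = DFA.final 𝒟 (runW 𝒟 (DFA.init 𝒟) w) ≡ true

-- The encoding C.  Σ̂ = Σ × {0,1} ∪ {$}; the bit is a Bool (true = 1).

data Hat (A : Set) : Set where
  sym    : A → Bool → Hat A
  dollar : Hat A

-- lexicographic enumeration of the nodes at level ℓ, each with its
-- label and the bit "has children"
levelNodes : {A : Set} → Tree A → ℕ → List (A × Bool)
levelNodes (leaf a)     zero    = (a , false) ∷ []
levelNodes (node a l r) zero    = (a , true) ∷ []
levelNodes (leaf a)     (suc ℓ) = []
levelNodes (node a l r) (suc ℓ) = levelNodes l ℓ ++ levelNodes r ℓ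

encLevel : {A : Set} → ℕ → Tree A → ℕ → List (Hat A)
encLevel K t ℓ =
  map (λ p → sym (Data.Product.proj₁ p) (Data.Product.proj₂ p)) (levelNodes t ℓ)
  ++ replicate (K ∸ length (levelNodes t ℓ)) dollar

encode : {A : Set} → ℕ → Tree A → List (Hat A)
encode K t = concatMap (encLevel K t) (upTo (suc (height t)))

Recognises : {Γ : Set} → TreeAut Γ → (Tree Γ → Set) → Set
Recognises 𝒜 L = ∀ c → AcceptsT 𝒜 c ⇔ L c

RecognisesW : {Γ : Set} → DFA Γ → (List Γ → Set) → Set
RecognisesW 𝒟 L = ∀ w → AcceptsW 𝒟 w ⇔ L w

convLang : {A : Set} {m : ℕ} → (Vec (Tree A) (suc m) → Set) → Tree (Vec (Maybe A) (suc m)) → Set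
convLang R c = Σ _ λ ts → R ts × convT ts ≡ c

encConvLang : {A : Set} {m : ℕ} → ℕ → (Vec (Tree A) (suc m) → Set) → List (Vec (Maybe (Hat A)) (suc m)) → Set
encConvLang K R w = Σ _ λ ts → R ts × convW (Vec.map (encode K) ts) ≡ w

-- C(t) lists the levels of t from the root down, each padded to K letters, so ⊗C(t₁,…,tₙ) is a
-- sequence of blocks of K letters, the ℓ-th block carrying the ℓ-th levels of all tᵢ side by side.
-- The word automaton cuts its input into such blocks, decodes each block into a tuple of levels
-- (rejecting blocks that do not re-encode to themselves) and reads these tuples top-down. Its state
-- records, for every node of the current level of the tree convolution ⊗(t₁,…,tₙ), which tᵢ contain
-- it, together with a table saying, for every assignment of states of the tree automaton to these
-- nodes, whether the bottom-up run then accepts at the root; reading a level merges the n columns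
-- into the convolution's level and precomposes the table with one bottom-up step. Thickness ≤ K
-- bounds every level of the convolution by nK nodes, so the reachable states are finitely many.
-- Conversely, an accepted word decodes column by column into the levels of trees t₁,…,tₙ of
-- thickness ≤ K whose convolution the tree automaton accepts, and convolution is injective.

module Submission where

open import Defs renaming (sym to symbol)
open import Data.Nat using (ℕ; zero; suc; _+_; _*_; _∸_; _⊔_; _≤_; _<_; _≤?_; _≟_; s≤s; z≤n)
open import Data.Nat.Properties
  using ( suc-injective; +-comm; ≤-refl; ≤-reflexive; ≤-trans; <-≤-trans; <⇒≤; ≤∧≢⇒<; ≰⇒>
        ; m+1+n≢m; m+[n∸m]≡n; m≤m+n; m≤n+m; +-mono-≤; m≤m⊔n; m≤n⊔m; ⊔-sel; ⊔-idem; ⊔-lub; ⊔-identityʳ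
        ; m≤n⇒m⊔n≡n; m≥n⇒m⊔n≡m; +-0-commutativeMonoid; module ≤-Reasoning)
open import Algebra.Properties.CommutativeMonoid.Sum +-0-commutativeMonoid using (sum; ∑-distrib-+; sum-cong-≋)
open import Data.Bool using (Bool; true; false; _∧_; _∨_; if_then_else_)
import Data.Bool.Properties as Bool
open import Data.Fin using (Fin; zero; suc; combine; remQuot)
open import Data.Fin.Properties using (all?; remQuot-combine)
import Data.Fin.Properties as Fin
open import Data.Maybe using (Maybe; just; nothing; maybe′; is-just)
import Data.Maybe as Maybe
import Data.Maybe.Properties as Maybe
import Data.Maybe.Relation.Unary.All as Maybe using (All; just; nothing)
open import Data.List
  using (List; []; _∷_; _++_; _∷ʳ_; [_]; length; map; concat; concatMap; foldl; null; replicate; applyUpTo; fromMaybe)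
open import Data.List.Properties
  using ( length-map; length-++; length-replicate; map-++; map-∘; map-id; map-replicate; ++-assoc; ++-identityʳ; ∷ʳ-++
        ; ++-conicalˡ; ++-conicalʳ; concatMap-++; concatMap-map; concatMap-cong; map-concatMap; map-upTo; map-applyUpTo)
import Data.List.Properties as List
open import Data.List.Relation.Binary.Pointwise using (Pointwise; []; _∷_; ++⁺)
open import Data.List.Relation.Unary.All using ([]; _∷_)
import Data.List.Relation.Unary.All as List using (All)
import Data.List.Relation.Unary.All.Properties as List using (++⁺)
open import Data.List.Relation.Unary.All.Properties using (applyUpTo⁺₁)
open import Data.Vec using (Vec; []; _∷_; head; tail; lookup; tabulate)
import Data.Vec as Vec
import Data.Vec.Properties as Vec
open import Data.Vec.Relation.Binary.Pointwise.Extensional using (ext; Pointwise-≡⇒≡)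
open import Data.Vec.Relation.Unary.All using (All; []; _∷_)
import Data.Vec.Relation.Unary.All as All using (map)
open import Data.Vec.Relation.Unary.All.Properties using (tabulate⁺; lookup⁺)
import Data.Vec.Relation.Unary.All.Properties as All using (map⁺)
open import Data.Vec.Relation.Unary.Any using (Any; here; there)
import Data.Vec.Relation.Unary.Any as Any using (map)
import Data.Vec.Relation.Unary.Any.Properties as Any using (map⁺)
open import Data.Product using (Σ-syntax; ∃-syntax; _×_; _,_; proj₁; proj₂; uncurry)
import Data.Product.Properties as Product
open import Data.Sum using (_⊎_; inj₁; inj₂; map₂)
open import Data.Unit using (tt)
open import Function using (_∘_; id; _⇔_; mk⇔; Equivalence)
open import Relation.Unary using (Pred; U; _⊆_; _⟨×⟩_)
open import Relation.Nullary using (Dec; yes; no; contradiction; _×-dec_)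
open import Relation.Nullary.Decidable using (map′)
open import Relation.Binary.Definitions using (DecidableEquality)
open import Relation.Binary.PropositionalEquality
  using (_≡_; _≢_; refl; sym; trans; cong; cong₂; subst; subst₂; module ≡-Reasoning)

record Code (X : Set) (Inv : Pred X _) : Set where
  field
    size          : ℕ
    toFin         : X → Fin size
    fromFin       : Fin size → X
    fromFin-toFin : ∀ {x} → Inv x → fromFin (toFin x) ≡ x

finCode : ∀ k → Code (Fin k) U
finCode k = record { size = k ; toFin = id ; fromFin = id ; fromFin-toFin = λ _ → refl }

weaken : ∀ {X P Q} → Code X P → Q ⊆ P → Code X Q
weaken c Q⊆P = record { Code c ; fromFin-toFin = Code.fromFin-toFin c ∘ Q⊆P }

retract : ∀ {X Y P} (c : Code Y P) (f : X → Y) (g : Y → X) → (∀ x → g (f x) ≡ x) → Code X (P ∘ f)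
retract c f g gf = record
  { size = Code.size c ; toFin = Code.toFin c ∘ f ; fromFin = g ∘ Code.fromFin c
  ; fromFin-toFin = λ {x} px → trans (cong g (Code.fromFin-toFin c px)) (gf x) }

_×-code_ : ∀ {X Y P Q} → Code X P → Code Y Q → Code (X × Y) (P ⟨×⟩ Q)
c ×-code d = record
  { size = Code.size c * Code.size d
  ; toFin = λ (x , y) → combine (Code.toFin c x) (Code.toFin d y)
  ; fromFin = λ j → let (a , b) = remQuot (Code.size d) j in Code.fromFin c a , Code.fromFin d b
  ; fromFin-toFin = λ {(x , y)} (px , qy) →
      trans (cong (λ (a , b) → Code.fromFin c a , Code.fromFin d b) (remQuot-combine (Code.toFin c x) (Code.toFin d y)))
            (cong₂ _,_ (Code.fromFin-toFin c px) (Code.fromFin-toFin d qy)) }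

maybeCode : ∀ {X P} → Code X P → Code (Maybe X) (Maybe.All P)
maybeCode {X} {P} c = record { size = suc (Code.size c) ; toFin = enc ; fromFin = dec ; fromFin-toFin = dec-enc }
  where
  enc : Maybe X → Fin (suc (Code.size c))
  enc nothing  = zero
  enc (just x) = suc (Code.toFin c x)
  dec : Fin (suc (Code.size c)) → Maybe X
  dec zero    = nothing
  dec (suc j) = just (Code.fromFin c j)
  dec-enc : ∀ {x} → Maybe.All P x → dec (enc x) ≡ x
  dec-enc (Maybe.just px) = cong just (Code.fromFin-toFin c px)
  dec-enc Maybe.nothing   = refl

boolCode : Code Bool U
boolCode = weaken (retract (maybeCode (finCode 1)) fromBool toBool toBool-fromBool) total
  where
  fromBool : Bool → Maybe (Fin 1)
  fromBool false = nothing
  fromBool true  = just zero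
  toBool : Maybe (Fin 1) → Bool
  toBool nothing  = false
  toBool (just _) = true
  toBool-fromBool : ∀ b → toBool (fromBool b) ≡ b
  toBool-fromBool false = refl
  toBool-fromBool true  = refl
  total : U ⊆ (Maybe.All U ∘ fromBool)
  total {false} _ = Maybe.nothing
  total {true}  _ = Maybe.just tt

vecCode : ∀ {X} → Code X U → ∀ k → Code (Vec X k) U
vecCode c zero    = record { size = 1 ; toFin = λ _ → zero ; fromFin = λ _ → [] ; fromFin-toFin = λ { {[]} _ → refl } }
vecCode c (suc k) = weaken (retract (c ×-code vecCode c k) uncons (uncurry _∷_) λ { (x ∷ xs) → refl }) λ _ → tt , tt
  where
  uncons : ∀ {X : Set} → Vec X (suc k) → X × Vec X k
  uncons (x ∷ xs) = x , xs

listCode : ∀ {X} → Code X U → ∀ W → Code (List X) (λ xs → length xs ≤ W)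
listCode c zero    = record { size = 1 ; toFin = λ _ → zero ; fromFin = λ _ → [] ; fromFin-toFin = λ { {[]} _ → refl } }
listCode c (suc W) = weaken (retract (maybeCode (c ×-code listCode c W)) uncons recons recons-uncons) bounded
  where
  uncons : ∀ {X : Set} → List X → Maybe (X × List X)
  uncons []       = nothing
  uncons (x ∷ xs) = just (x , xs)
  recons : ∀ {X : Set} → Maybe (X × List X) → List X
  recons nothing          = []
  recons (just (x , xs)) = x ∷ xs
  recons-uncons : ∀ {X : Set} (xs : List X) → recons (uncons xs) ≡ xs
  recons-uncons []       = refl
  recons-uncons (x ∷ xs) = refl
  bounded : ∀ {xs} → length xs ≤ suc W → Maybe.All (U ⟨×⟩ (λ ys → length ys ≤ W)) (uncons xs)
  bounded {[]}     _         = Maybe.nothing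
  bounded {x ∷ xs} (s≤s ≤W) = Maybe.just (tt , ≤W)

record Automaton (Γ : Set) : Set₁ where
  field
    State     : Set
    start     : State
    step      : State → Γ → State
    accepting : State → Bool

  run : State → List Γ → State
  run = foldl step

  Accepts : List Γ → Set
  Accepts w = accepting (run start w) ≡ true

record FinitelyCoded {Γ : Set} (𝒜 : Automaton Γ) : Set₁ where
  open Automaton 𝒜
  field
    Invariant : Pred State _
    code      : Code State Invariant
    start-inv : Invariant start
    step-inv  : ∀ {s} a → Invariant s → Invariant (step s a)

module _ {Γ : Set} (𝒜 : Automaton Γ) (fin : FinitelyCoded 𝒜) where
  open Automaton 𝒜
  open FinitelyCoded fin
  open Code code

  toDFA : DFA Γ
  toDFA = record
    { states = size ; init = toFin start
    ; δ = λ q a → toFin (step (fromFin q) a) ; final = accepting ∘ fromFin }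

  private
    runW-fromFin : ∀ {s} → Invariant s → ∀ w → fromFin (runW toDFA (toFin s) w) ≡ run s w
    runW-fromFin inv []      = fromFin-toFin inv
    runW-fromFin inv (a ∷ w) rewrite fromFin-toFin inv = runW-fromFin (step-inv a inv) w

  toDFA-accepts : ∀ w → AcceptsW toDFA w ⇔ Accepts w
  toDFA-accepts w = mk⇔ (trans (cong accepting (sym agree))) (trans (cong accepting agree))
    where agree = runW-fromFin start-inv w

module _ {Γ : Set} (K : ℕ) (𝒜 : Automaton (List Γ)) where
  private module 𝒜 = Automaton 𝒜

  pushLetter : 𝒜.State × List Γ → Γ → 𝒜.State × List Γ
  pushLetter (s , buf) a with length (buf ∷ʳ a) ≟ K
  ... | yes _ = 𝒜.step s (buf ∷ʳ a) , []
  ... | no  _ = s , buf ∷ʳ a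

  chunked : Automaton Γ
  chunked = record
    { State = 𝒜.State × List Γ ; start = 𝒜.start , [] ; step = pushLetter
    ; accepting = λ (s , buf) → null buf ∧ 𝒜.accepting s }

  open Automaton chunked using (run)

  private
    length-++-∷-≢ : ∀ (xs : List Γ) y ys → length (xs ++ y ∷ ys) ≢ length xs
    length-++-∷-≢ xs y ys eq = m+1+n≢m (length xs) (trans (sym (length-++ xs)) eq)

  run-block : ∀ s buf a b w → length (buf ++ a ∷ b) ≡ K →
              run (s , buf) ((a ∷ b) ++ w) ≡ run (𝒜.step s (buf ++ a ∷ b) , []) w
  run-block s buf a []      w full with length (buf ∷ʳ a) ≟ K
  ... | yes _   = refl
  ... | no  ≢K  = contradiction full ≢K
  run-block s buf a (c ∷ b) w full with length (buf ∷ʳ a) ≟ K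
  ... | yes ≡K  = contradiction (trans full′ (sym ≡K)) (length-++-∷-≢ (buf ∷ʳ a) c b)
    where full′ = trans (cong length (∷ʳ-++ buf a (c ∷ b))) full
  ... | no  _   = trans (run-block s (buf ∷ʳ a) c b w (trans (cong length (∷ʳ-++ buf a (c ∷ b))) full))
                        (cong (λ buf′ → run (𝒜.step s buf′ , []) w) (∷ʳ-++ buf a (c ∷ b)))

  run-blocks : 0 < K → ∀ s bs → List.All (λ b → length b ≡ K) bs →
               run (s , []) (concat bs) ≡ (𝒜.run s bs , [])
  run-blocks 0<K s []      []         = refl
  run-blocks 0<K s (b ∷ bs) (len ∷ lens) with b
  ... | []    = contradiction (subst (0 <_) (sym len) 0<K) λ ()
  ... | a ∷ b′ = trans (run-block s [] a b′ (concat bs) len) (run-blocks 0<K (𝒜.step s (a ∷ b′)) bs lens)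

  blocks-of-accepted : ∀ s buf w → Automaton.accepting chunked (run (s , buf) w) ≡ true →
    ∃[ bs ] List.All (λ b → length b ≡ K) bs × concat bs ≡ buf ++ w × 𝒜.accepting (𝒜.run s bs) ≡ true
  blocks-of-accepted s []        [] acc = [] , [] , refl , acc
  blocks-of-accepted s (_ ∷ _)   [] ()
  blocks-of-accepted s buf (a ∷ w) acc with length (buf ∷ʳ a) ≟ K
  ... | yes full with blocks-of-accepted (𝒜.step s (buf ∷ʳ a)) [] w acc
  ...   | bs , lens , concat≡ , acc′ =
    (buf ∷ʳ a) ∷ bs , full ∷ lens , trans (cong (buf ∷ʳ a ++_) concat≡) (∷ʳ-++ buf a w) , acc′
  blocks-of-accepted s buf (a ∷ w) acc | no _ with blocks-of-accepted s (buf ∷ʳ a) w acc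
  ...   | bs , lens , concat≡ , acc′ = bs , lens , trans concat≡ (∷ʳ-++ buf a w) , acc′

  chunked-accepts : 0 < K → ∀ w →
    Automaton.Accepts chunked w ⇔ (∃[ bs ] List.All (λ b → length b ≡ K) bs × concat bs ≡ w × 𝒜.Accepts bs)
  chunked-accepts 0<K w = mk⇔ (blocks-of-accepted 𝒜.start [] w)
    λ (bs , lens , concat≡ , acc) → subst (Automaton.Accepts chunked) concat≡
      (trans (cong (Automaton.accepting chunked) (run-blocks 0<K 𝒜.start bs lens)) acc)

  chunked-coded : FinitelyCoded 𝒜 → Code Γ U → 0 < K → FinitelyCoded chunked
  chunked-coded fin letters 0<K = record
    { Invariant = Invariant ⟨×⟩ (λ buf → length buf < K)
    ; code      = weaken (code ×-code listCode letters K) (λ (inv , short) → inv , <⇒≤ short)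
    ; start-inv = start-inv , 0<K
    ; step-inv  = λ {sb} → step-inv′ {sb} }
    where
    open FinitelyCoded fin
    step-inv′ : ∀ {sb} a → (Invariant ⟨×⟩ (λ buf → length buf < K)) sb →
                (Invariant ⟨×⟩ (λ buf → length buf < K)) (pushLetter sb a)
    step-inv′ {s , buf} a (inv , short) with length (buf ∷ʳ a) ≟ K
    ... | yes _ = step-inv (buf ∷ʳ a) inv , 0<K
    ... | no ≢K = inv , ≤∧≢⇒< (subst (_≤ K) (sym (trans (length-++ buf) (+-comm (length buf) 1))) short) ≢K

module _ {A B : Set} (decode : A → Maybe B) (𝒜 : Automaton B) where
  private module 𝒜 = Automaton 𝒜

  decodeStep : Maybe 𝒜.State → A → Maybe 𝒜.State
  decodeStep nothing  a = nothing
  decodeStep (just s) a with decode a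
  ... | nothing = nothing
  ... | just b  = just (𝒜.step s b)

  decoding : Automaton A
  decoding = record
    { State = Maybe 𝒜.State ; start = just 𝒜.start ; step = decodeStep
    ; accepting = maybe′ 𝒜.accepting false }

  open Automaton decoding using (run; accepting)

  private
    run-rejected : ∀ as → run nothing as ≡ nothing
    run-rejected []       = refl
    run-rejected (a ∷ as) = run-rejected as

  module _ (enc : B → A) where

    decoded-of-accepted : (∀ {a b} → decode a ≡ just b → enc b ≡ a) →
      ∀ s as → accepting (run (just s) as) ≡ true →
      ∃[ bs ] map enc bs ≡ as × 𝒜.accepting (𝒜.run s bs) ≡ true
    decoded-of-accepted sound s []       acc = [] , refl , acc
    decoded-of-accepted sound s (a ∷ as) acc with decode a in decode≡
    ... | nothing rewrite run-rejected as = contradiction acc λ ()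
    ... | just b with decoded-of-accepted sound (𝒜.step s b) as acc
    ...   | bs , map≡ , acc′ = b ∷ bs , cong₂ _∷_ (sound decode≡) map≡ , acc′

    run-encoded : (∀ b → decode (enc b) ≡ just b) → ∀ s bs → run (just s) (map enc bs) ≡ just (𝒜.run s bs)
    run-encoded complete s []       = refl
    run-encoded complete s (b ∷ bs) rewrite complete b = run-encoded complete (𝒜.step s b) bs

    decoding-accepts : (∀ {a b} → decode a ≡ just b → enc b ≡ a) → (∀ b → decode (enc b) ≡ just b) →
      ∀ as → Automaton.Accepts decoding as ⇔ (∃[ bs ] map enc bs ≡ as × 𝒜.Accepts bs)
    decoding-accepts sound complete as = mk⇔ (decoded-of-accepted sound 𝒜.start as)
      λ (bs , map≡ , acc) → subst (Automaton.Accepts decoding) map≡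
        (trans (cong accepting (run-encoded complete 𝒜.start bs)) acc)

  decoding-coded : FinitelyCoded 𝒜 → FinitelyCoded decoding
  decoding-coded fin = record
    { Invariant = Maybe.All Invariant
    ; code      = maybeCode code
    ; start-inv = Maybe.just start-inv
    ; step-inv  = step-inv′ }
    where
    open FinitelyCoded fin
    step-inv′ : ∀ {s} a → Maybe.All Invariant s → Maybe.All Invariant (decodeStep s a)
    step-inv′ a Maybe.nothing = Maybe.nothing
    step-inv′ {just s} a (Maybe.just inv) with decode a
    ... | nothing = Maybe.nothing
    ... | just b  = Maybe.just (step-inv b inv)

module _ {A B : Set} (_≟ᴬ_ : DecidableEquality A) (enc : B → A) (dec : A → B) where

  checkedDecode : A → Maybe B
  checkedDecode a with enc (dec a) ≟ᴬ a
  ... | yes _ = just (dec a)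
  ... | no  _ = nothing

  checkedDecode-sound : ∀ {a b} → checkedDecode a ≡ just b → enc b ≡ a
  checkedDecode-sound {a} eq with enc (dec a) ≟ᴬ a
  checkedDecode-sound refl | yes enc-dec = enc-dec

  checkedDecode-complete : (∀ b → dec (enc b) ≡ b) → ∀ b → checkedDecode (enc b) ≡ just b
  checkedDecode-complete dec∘enc b with enc (dec (enc b)) ≟ᴬ enc b
  ... | yes _ = cong just (dec∘enc b)
  ... | no ≢  = contradiction (cong enc (dec∘enc b)) ≢

-- Levels of trees and forests

module _ {A : Set} where

  info : Tree A → A × Bool
  info (leaf a)     = a , false
  info (node a _ _) = a , true

  children : Tree A → List (Tree A)
  children (leaf _)     = []
  children (node _ l r) = l ∷ r ∷ []

  nextLevel : List (Tree A) → List (Tree A)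
  nextLevel = concatMap children

  nodesAt : List (Tree A) → ℕ → List (A × Bool)
  nodesAt F ℓ = concatMap (λ t → levelNodes t ℓ) F

  nodesAt-zero : ∀ F → nodesAt F 0 ≡ map info F
  nodesAt-zero []                = refl
  nodesAt-zero (leaf _ ∷ F)      = cong (_ ∷_) (nodesAt-zero F)
  nodesAt-zero (node _ _ _ ∷ F)  = cong (_ ∷_) (nodesAt-zero F)

  levelNodes-suc : ∀ t ℓ → levelNodes t (suc ℓ) ≡ nodesAt (children t) ℓ
  levelNodes-suc (leaf _)     ℓ = refl
  levelNodes-suc (node _ l r) ℓ = cong (levelNodes l ℓ ++_) (sym (++-identityʳ (levelNodes r ℓ)))

  nodesAt-suc : ∀ F ℓ → nodesAt F (suc ℓ) ≡ nodesAt (nextLevel F) ℓ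
  nodesAt-suc []      ℓ = refl
  nodesAt-suc (t ∷ F) ℓ = trans (cong₂ _++_ (levelNodes-suc t ℓ) (nodesAt-suc F ℓ))
                                (sym (concatMap-++ (λ t → levelNodes t ℓ) (children t) (nextLevel F)))

  nodesAt-singleton : ∀ t ℓ → nodesAt [ t ] ℓ ≡ levelNodes t ℓ
  nodesAt-singleton t ℓ = ++-identityʳ (levelNodes t ℓ)

  levelCount≡length : ∀ (t : Tree A) ℓ → levelCount t ℓ ≡ length (levelNodes t ℓ)
  levelCount≡length (leaf _)     zero    = refl
  levelCount≡length (node _ _ _) zero    = refl
  levelCount≡length (leaf _)     (suc ℓ) = refl
  levelCount≡length (node _ l r) (suc ℓ) =
    trans (cong₂ _+_ (levelCount≡length l ℓ) (levelCount≡length r ℓ)) (sym (length-++ (levelNodes l ℓ)))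

  levelNodes-beyond : ∀ (t : Tree A) ℓ → height t < ℓ → levelNodes t ℓ ≡ []
  levelNodes-beyond (leaf _)     (suc ℓ) _ = refl
  levelNodes-beyond (node _ l r) (suc ℓ) (s≤s h<ℓ) =
    cong₂ _++_ (levelNodes-beyond l ℓ (≤-trans (s≤s (m≤m⊔n _ _)) h<ℓ))
               (levelNodes-beyond r ℓ (≤-trans (s≤s (m≤n⊔m _ _)) h<ℓ))

  levelNodes-within : ∀ (t : Tree A) ℓ → ℓ ≤ height t → levelNodes t ℓ ≢ []
  levelNodes-within (leaf _)     zero    _ ()
  levelNodes-within (node _ _ _) zero    _ ()
  levelNodes-within (node _ l r) (suc ℓ) (s≤s ℓ≤h) with ⊔-sel (height l) (height r)
  ... | inj₁ h≡l = levelNodes-within l ℓ (≤-trans ℓ≤h (≤-reflexive h≡l)) ∘ ++-conicalˡ _ _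
  ... | inj₂ h≡r = levelNodes-within r ℓ (≤-trans ℓ≤h (≤-reflexive h≡r)) ∘ ++-conicalʳ _ _

  height-below : ∀ (t : Tree A) ℓ → levelNodes t ℓ ≡ [] → height t < ℓ
  height-below t ℓ empty = ≰⇒> λ ℓ≤h → levelNodes-within t ℓ ℓ≤h empty

  levelNodes-thin : ∀ K (t : Tree A) → ThicknessAtMost K t → ∀ ℓ → length (levelNodes t ℓ) ≤ K
  levelNodes-thin K t thin ℓ = ≤-trans (≤-reflexive (sym (levelCount≡length t ℓ))) (thin ℓ)

-- Convolution of trees

anyTrue : ∀ {k} → Vec Bool k → Bool
anyTrue = Vec.foldr′ _∨_ false

≤-sum : ∀ {k} (f : Fin k → ℕ) i → f i ≤ sum f
≤-sum f zero    = m≤m+n (f zero) _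
≤-sum f (suc i) = ≤-trans (≤-sum (f ∘ suc) i) (m≤n+m _ (f zero))

sum-≤ : ∀ {k K} (f : Fin k → ℕ) → (∀ i → f i ≤ K) → sum f ≤ k * K
sum-≤ {zero}  f _   = z≤n
sum-≤ {suc k} f f≤K = +-mono-≤ (f≤K zero) (sum-≤ (f ∘ suc) (f≤K ∘ suc))

module _ {A : Set} where

  isInner : Maybe (A × Bool) → Bool
  isInner = maybe′ proj₂ false

  rowLabel : ∀ {k} → Vec (Maybe (A × Bool)) k → Vec (Maybe A) k
  rowLabel = Vec.map (Maybe.map proj₁)

  rowInner : ∀ {k} → Vec (Maybe (A × Bool)) k → Bool
  rowInner r = anyTrue (Vec.map isInner r)

  rowNode : ∀ {k} → Vec (Maybe (A × Bool)) k → Vec (Maybe A) k × Bool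
  rowNode r = rowLabel r , rowInner r

Row : Set → ℕ → Set
Row A k = Vec (Maybe (Tree A)) k

module _ {A : Set} where

  infos : ∀ {k} → Row A k → Vec (Maybe (A × Bool)) k
  infos = Vec.map (Maybe.map info)

  left right : Maybe (Tree A) → Maybe (Tree A)
  left  (just (node _ l _)) = just l
  left  _                   = nothing
  right (just (node _ _ r)) = just r
  right _                   = nothing

  -- Convolves v c: c is the convolution of the trees present in the row v (absent ones are nothing).
  data Convolves {k} : Row A k → Tree (Vec (Maybe A) k) → Set where
    leaf : ∀ {v} → rowInner (infos v) ≡ false → Convolves v (leaf (rowLabel (infos v)))
    node : ∀ {v l r} → rowInner (infos v) ≡ true →
           Convolves (Vec.map left v) l → Convolves (Vec.map right v) r →
           Convolves v (node (rowLabel (infos v)) l r)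

  Convolves-info : ∀ {k v} {c : Tree (Vec (Maybe A) k)} → Convolves v c → info c ≡ rowNode (infos v)
  Convolves-info {v = v} (leaf outer)     = cong (rowLabel (infos v) ,_) (sym outer)
  Convolves-info {v = v} (node inner _ _) = cong (rowLabel (infos v) ,_) (sym inner)

  outer-left : ∀ {k} (v : Row A k) → rowInner (infos v) ≡ false → Vec.map left v ≡ Vec.replicate k nothing
  outer-left []                    _     = refl
  outer-left (nothing ∷ v)         outer = cong (nothing ∷_) (outer-left v outer)
  outer-left (just (leaf _) ∷ v)   outer = cong (nothing ∷_) (outer-left v outer)

  outer-right : ∀ {k} (v : Row A k) → rowInner (infos v) ≡ false → Vec.map right v ≡ Vec.replicate k nothing
  outer-right []                    _     = refl
  outer-right (nothing ∷ v)         outer = cong (nothing ∷_) (outer-right v outer)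
  outer-right (just (leaf _) ∷ v)   outer = cong (nothing ∷_) (outer-right v outer)

  Convolves-padHead : ∀ {k v} {c : Tree (Vec (Maybe A) k)} → Convolves v c → Convolves (nothing ∷ v) (padHead c)
  Convolves-padHead (leaf outer)       = leaf outer
  Convolves-padHead (node inner cl cr) = node inner (Convolves-padHead cl) (Convolves-padHead cr)

  rowLabel-blank : ∀ m → rowLabel (infos (Vec.replicate m nothing)) ≡ Vec.replicate m nothing
  rowLabel-blank zero    = refl
  rowLabel-blank (suc m) = cong (nothing ∷_) (rowLabel-blank m)

  rowInner-blank : ∀ m → rowInner (infos (Vec.replicate m nothing)) ≡ false
  rowInner-blank zero    = refl
  rowInner-blank (suc m) = rowInner-blank m

  Convolves-padTail : ∀ m (t : Tree A) → Convolves (just t ∷ Vec.replicate m nothing) (padTail t)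
  Convolves-padTail m (leaf a) =
    subst (λ lab → Convolves (just (leaf a) ∷ blankRow) (leaf (just a ∷ lab)))
          (rowLabel-blank m) (leaf (rowInner-blank m))
    where blankRow = Vec.replicate m nothing
  Convolves-padTail m (node a l r) =
    subst (λ lab → Convolves (just (node a l r) ∷ blankRow) (node (just a ∷ lab) (padTail l) (padTail r)))
          (rowLabel-blank m)
          (node refl (subst (λ w → Convolves (just l ∷ w) (padTail l)) (sym (Vec.map-replicate left nothing m))
                            (Convolves-padTail m l))
                     (subst (λ w → Convolves (just r ∷ w) (padTail r)) (sym (Vec.map-replicate right nothing m))
                            (Convolves-padTail m r)))
    where blankRow = Vec.replicate m nothing

  Convolves-consT : ∀ {m v} (t : Tree A) {c : Tree (Vec (Maybe A) m)} →
                    Convolves v c → Convolves (just t ∷ v) (consT t c)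
  Convolves-consT (leaf a)     (leaf outer)        = leaf outer
  Convolves-consT (leaf a)     (node inner cl cr)  = node inner (Convolves-padHead cl) (Convolves-padHead cr)
  Convolves-consT {v = v} (node a l r) (leaf outer) =
    node refl (subst (λ w → Convolves (just l ∷ w) (padTail l)) (sym (outer-left v outer)) (Convolves-padTail _ l))
              (subst (λ w → Convolves (just r ∷ w) (padTail r)) (sym (outer-right v outer)) (Convolves-padTail _ r))
  Convolves-consT (node a l r) (node _ cl cr)      = node refl (Convolves-consT l cl) (Convolves-consT r cr)

  Convolves-convT : ∀ {m} (ts : Vec (Tree A) (suc m)) → Convolves (Vec.map just ts) (convT ts)
  Convolves-convT (t ∷ [])     = Convolves-padTail 0 t
  Convolves-convT (t ∷ u ∷ ts) = Convolves-consT t (Convolves-convT (u ∷ ts))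

  private
    entry-determined : ∀ (x y : Maybe (Tree A)) →
                       Maybe.map proj₁ (Maybe.map info x) ≡ Maybe.map proj₁ (Maybe.map info y) →
                       left x ≡ left y → right x ≡ right y → x ≡ y
    entry-determined nothing             nothing             _    _    _    = refl
    entry-determined (just (leaf _))     (just (leaf _))     refl _    _    = refl
    entry-determined (just (node _ _ _)) (just (node _ _ _)) refl refl refl = refl
    entry-determined nothing             (just _)            ()
    entry-determined (just _)            nothing             ()
    entry-determined (just (leaf _))     (just (node _ _ _)) _    ()
    entry-determined (just (node _ _ _)) (just (leaf _))     _    ()

  row-determined : ∀ {k} (v w : Row A k) → rowLabel (infos v) ≡ rowLabel (infos w) →
                   Vec.map left v ≡ Vec.map left w → Vec.map right v ≡ Vec.map right w → v ≡ w
  row-determined []      []      _    _  _  = refl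
  row-determined (x ∷ v) (y ∷ w) lab≡ l≡ r≡ =
    cong₂ _∷_ (entry-determined x y (Vec.∷-injectiveˡ lab≡) (Vec.∷-injectiveˡ l≡) (Vec.∷-injectiveˡ r≡))
              (row-determined v w (Vec.∷-injectiveʳ lab≡) (Vec.∷-injectiveʳ l≡) (Vec.∷-injectiveʳ r≡))

  Convolves-injective : ∀ {k v w} {c d : Tree (Vec (Maybe A) k)} → Convolves v c → Convolves w d → c ≡ d → v ≡ w
  Convolves-injective {v = v} {w} (leaf outerᵛ) (leaf outerʷ) eq =
    row-determined v w (cong (proj₁ ∘ info) eq) (trans (outer-left v outerᵛ) (sym (outer-left w outerʷ)))
                            (trans (outer-right v outerᵛ) (sym (outer-right w outerʷ)))
  Convolves-injective {v = v} {w} (node _ cl cr) (node _ dl dr) eq =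
    row-determined v w (cong (proj₁ ∘ info) eq)
      (Convolves-injective cl dl (List.∷-injectiveˡ children≡))
      (Convolves-injective cr dr (List.∷-injectiveˡ (List.∷-injectiveʳ children≡)))
    where children≡ = cong children eq

  convT-injective : ∀ {m} (ts us : Vec (Tree A) (suc m)) → convT ts ≡ convT us → ts ≡ us
  convT-injective ts us eq = map-just-injective (Convolves-injective (Convolves-convT ts) (Convolves-convT us) eq)
    where
    map-just-injective : ∀ {k} {ts us : Vec (Tree A) k} → Vec.map just ts ≡ Vec.map just us → ts ≡ us
    map-just-injective {ts = []}     {[]}     _  = refl
    map-just-injective {ts = t ∷ ts} {u ∷ us} eq with Vec.∷-injective eq
    ... | refl , eq′ = cong (t ∷_) (map-just-injective eq′)

  childRows : ∀ {k} → Row A k → List (Row A k)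
  childRows v = if rowInner (infos v) then Vec.map left v ∷ Vec.map right v ∷ [] else []

  nextRows : ∀ {k} → List (Row A k) → List (Row A k)
  nextRows = concatMap childRows

  Convolves-nextLevel : ∀ {k U} {F : List (Tree (Vec (Maybe A) k))} →
                        Pointwise Convolves U F → Pointwise Convolves (nextRows U) (nextLevel F)
  Convolves-nextLevel []         = []
  Convolves-nextLevel (cv ∷ cvs) = ++⁺ (Convolves-children cv) (Convolves-nextLevel cvs)
    where
    Convolves-children : ∀ {v c} → Convolves v c → Pointwise Convolves (childRows v) (children c)
    Convolves-children (leaf outer)       rewrite outer = []
    Convolves-children (node inner cl cr) rewrite inner = cl ∷ cr ∷ []

  Convolves-infos : ∀ {k U} {F : List (Tree (Vec (Maybe A) k))} →
                    Pointwise Convolves U F → map info F ≡ map (rowNode ∘ infos) U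
  Convolves-infos []         = refl
  Convolves-infos (cv ∷ cvs) = cong₂ _∷_ (Convolves-info cv) (Convolves-infos cvs)

  column : ∀ {k} → Fin k → List (Row A k) → List (Tree A)
  column i = concatMap (fromMaybe ∘ (λ v → lookup v i))

  column-nextRows : ∀ {k} (i : Fin k) U → column i (nextRows U) ≡ nextLevel (column i U)
  column-nextRows i []      = refl
  column-nextRows i (v ∷ U) = begin
    column i (childRows v ++ nextRows U)
      ≡⟨ concatMap-++ _ (childRows v) (nextRows U) ⟩
    column i (childRows v) ++ column i (nextRows U)
      ≡⟨ cong₂ _++_ (column-childRows v) (column-nextRows i U) ⟩
    nextLevel (fromMaybe (lookup v i)) ++ nextLevel (column i U)
      ≡⟨ concatMap-++ children (fromMaybe (lookup v i)) _ ⟨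
    nextLevel (column i (v ∷ U)) ∎
    where
    open ≡-Reasoning
    entry-children : ∀ x → fromMaybe (left x) ++ fromMaybe (right x) ++ [] ≡ nextLevel (fromMaybe x)
    entry-children nothing             = refl
    entry-children (just (leaf _))     = refl
    entry-children (just (node _ _ _)) = refl
    entry-leaf : ∀ x → left x ≡ nothing → [] ≡ nextLevel (fromMaybe x)
    entry-leaf nothing         _ = refl
    entry-leaf (just (leaf _)) _ = refl
    column-childRows : ∀ v → column i (childRows v) ≡ nextLevel (fromMaybe (lookup v i))
    column-childRows v with rowInner (infos v) in inner
    ... | true  rewrite Vec.lookup-map i left v | Vec.lookup-map i right v = entry-children (lookup v i)
    ... | false = entry-leaf (lookup v i)
      (trans (sym (Vec.lookup-map i left v))
             (trans (cong (λ w → lookup w i) (outer-left v inner)) (Vec.lookup-replicate i nothing)))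

  RowPresent : ∀ {k} → Row A k → Set
  RowPresent v = Σ[ i ∈ Fin _ ] is-just (lookup v i) ≡ true

  nextRows-present : ∀ {k} (U : List (Row A k)) → List.All RowPresent (nextRows U)
  nextRows-present []      = []
  nextRows-present (v ∷ U) = List.++⁺ (childRows-present v) (nextRows-present U)
    where
    some-inner : ∀ {k} (bs : Vec Bool k) → anyTrue bs ≡ true → Σ[ i ∈ Fin k ] lookup bs i ≡ true
    some-inner (true  ∷ bs) _   = zero , refl
    some-inner (false ∷ bs) any = let i , eq = some-inner bs any in suc i , eq
    inner-children : ∀ x → isInner (Maybe.map info x) ≡ true → is-just (left x) ≡ true × is-just (right x) ≡ true
    inner-children (just (node _ _ _)) _ = refl , refl
    childRows-present : ∀ {k} (v : Row A k) → List.All RowPresent (childRows v)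
    childRows-present v with rowInner (infos v) in inner
    ... | false = []
    ... | true with some-inner (Vec.map isInner (infos v)) inner
    ...   | i , inner-i with inner-children (lookup v i) (trans (sym (lookup-infos i)) inner-i)
      where lookup-infos = λ i → trans (Vec.lookup-map i isInner (infos v))
                                       (cong isInner (Vec.lookup-map i (Maybe.map info) v))
    ...     | l , r = (i , trans (cong is-just (Vec.lookup-map i left v)) l)
                    ∷ (i , trans (cong is-just (Vec.lookup-map i right v)) r) ∷ []

  length-≤-columns : ∀ {k} (U : List (Row A k)) → List.All RowPresent U →
                     length U ≤ sum (λ i → length (column i U))
  length-≤-columns []      []                          = z≤n
  length-≤-columns (v ∷ U) ((i , present) ∷ presents) = begin
    1 + length U
      ≤⟨ +-mono-≤ (≤-trans (entry-present (lookup v i) present) (≤-sum (λ j → length (fromMaybe (lookup v j))) i))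
                  (length-≤-columns U presents) ⟩
    sum (λ j → length (fromMaybe (lookup v j))) + sum (λ j → length (column j U))
      ≡⟨ ∑-distrib-+ (λ j → length (fromMaybe (lookup v j))) (λ j → length (column j U)) ⟨
    sum (λ j → length (fromMaybe (lookup v j)) + length (column j U))
      ≡⟨ sum-cong-≋ (λ j → sym (length-++ (fromMaybe (lookup v j)))) ⟩
    sum (λ j → length (column j (v ∷ U)))                                     ∎
    where
    open ≤-Reasoning
    entry-present : ∀ (x : Maybe (Tree A)) → is-just x ≡ true → 1 ≤ length (fromMaybe x)
    entry-present (just _) _ = s≤s z≤n

  rows-ended : ∀ {k} (U : List (Row A k)) → List.All RowPresent U → (∀ i → column i U ≡ []) → U ≡ []
  rows-ended []      _                      _     = refl
  rows-ended (v ∷ U) ((i , present) ∷ _) ended = contradiction (ended i) (entry-nonempty (lookup v i) present)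
    where
    entry-nonempty : ∀ x → is-just x ≡ true → fromMaybe x ++ column i U ≢ []
    entry-nonempty (just _) _ ()

module _ {A : Set} where

  maxHeight : ∀ {k} → Vec (Tree A) k → ℕ
  maxHeight = Vec.foldr′ (λ t h → height t ⊔ h) 0

  height≤maxHeight : ∀ {k} (ts : Vec (Tree A) k) → All (λ t → height t ≤ maxHeight ts) ts
  height≤maxHeight []       = []
  height≤maxHeight (t ∷ ts) =
    m≤m⊔n (height t) _ ∷ All.map (λ h≤ → ≤-trans h≤ (m≤n⊔m (height t) _)) (height≤maxHeight ts)

  reaches-maxHeight : ∀ {k} ℓ (ts : Vec (Tree A) (suc k)) → ℓ ≤ maxHeight ts → Any (λ t → ℓ ≤ height t) ts
  reaches-maxHeight ℓ (t ∷ [])     ℓ≤ = here (≤-trans ℓ≤ (≤-reflexive (⊔-identityʳ (height t))))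
  reaches-maxHeight ℓ (t ∷ u ∷ ts) ℓ≤ with ⊔-sel (height t) (maxHeight (u ∷ ts))
  ... | inj₁ max≡t = here (≤-trans ℓ≤ (≤-reflexive max≡t))
  ... | inj₂ max≡u = there (reaches-maxHeight ℓ (u ∷ ts) (≤-trans ℓ≤ (≤-reflexive max≡u)))

replicate-++ : ∀ {B : Set} a b (x : B) → replicate a x ++ replicate b x ≡ replicate (a + b) x
replicate-++ zero    b x = refl
replicate-++ (suc a) b x = cong (x ∷_) (replicate-++ a b x)

concat-applyUpTo-[] : ∀ {B : Set} (f : ℕ → List B) H → (∀ ℓ → f ℓ ≡ []) → concat (applyUpTo f H) ≡ []
concat-applyUpTo-[] f zero    _     = refl
concat-applyUpTo-[] f (suc H) empty rewrite empty 0 = concat-applyUpTo-[] (f ∘ suc) H (empty ∘ suc)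

applyUpTo-cong : ∀ {B : Set} {f g : ℕ → B} → (∀ ℓ → f ℓ ≡ g ℓ) → ∀ H → applyUpTo f H ≡ applyUpTo g H
applyUpTo-cong f≗g zero    = refl
applyUpTo-cong f≗g (suc H) = cong₂ _∷_ (f≗g 0) (applyUpTo-cong (f≗g ∘ suc) H)

FullOrEnded : ∀ {C : Set} → ℕ → List C → List C → Set
FullOrEnded K u v = length u ≡ K ⊎ (u ≡ [] × v ≡ [])

module _ {A : Set} where


  blank : ∀ k → Vec (Maybe A) k
  blank k = Vec.replicate k nothing

  length-consW : ∀ {k} (u : List A) (ws : List (Vec (Maybe A) k)) → length (consW u ws) ≡ length u ⊔ length ws
  length-consW []      ws       = length-map _ ws
  length-consW (x ∷ u) []       = cong suc (trans (length-consW u []) (⊔-identityʳ (length u)))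
  length-consW (x ∷ u) (w ∷ ws) = cong suc (length-consW u ws)

  length-convW-≤ : ∀ {K k} (us : Vec (List A) k) → All (λ u → length u ≤ K) us → length (convW us) ≤ K
  length-convW-≤ []       []           = z≤n
  length-convW-≤ (u ∷ us) (u≤ ∷ us≤) rewrite length-consW u (convW us) = ⊔-lub u≤ (length-convW-≤ us us≤)

  length-convW-≡ : ∀ {K k} (us : Vec (List A) k) → All (λ u → length u ≤ K) us → Any (λ u → length u ≡ K) us →
                   length (convW us) ≡ K
  length-convW-≡ (u ∷ us) (_ ∷ us≤) (here u≡K) =
    trans (length-consW u (convW us)) (trans (cong (_⊔ _) u≡K) (m≥n⇒m⊔n≡m (length-convW-≤ us us≤)))
  length-convW-≡ (u ∷ us) (u≤ ∷ us≤) (there any) =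
    trans (length-consW u (convW us)) (trans (cong (length u ⊔_) (length-convW-≡ us us≤ any)) (m≤n⇒m⊔n≡n u≤))

  private
    consW-++ : ∀ {k} (u v : List A) (ws vs : List (Vec (Maybe A) k)) → length u ≡ length ws →
               consW (u ++ v) (ws ++ vs) ≡ consW u ws ++ consW v vs
    consW-++ []      v []       vs _   = refl
    consW-++ (x ∷ u) v (w ∷ ws) vs len = cong (_ ∷_) (consW-++ u v ws vs (suc-injective len))

    consW-++-[] : ∀ {k} (u v : List A) → consW {n = k} (u ++ v) [] ≡ consW u [] ++ consW v []
    consW-++-[] []      v = refl
    consW-++-[] (x ∷ u) v = cong (_ ∷_) (consW-++-[] u v)

    consW-++-blocks : ∀ {K k} {u v : List A} {ws vs : List (Vec (Maybe A) k)} →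
      FullOrEnded K u v → FullOrEnded K ws vs →
      consW (u ++ v) (ws ++ vs) ≡ consW u ws ++ consW v vs × FullOrEnded K (consW u ws) (consW v vs)
    consW-++-blocks {u = u} {v} {ws} {vs} (inj₁ u≡K) (inj₁ ws≡K) =
      consW-++ u v ws vs (trans u≡K (sym ws≡K)) ,
      inj₁ (trans (length-consW u ws) (trans (cong₂ _⊔_ u≡K ws≡K) (⊔-idem _)))
    consW-++-blocks {u = u} {v} (inj₁ u≡K) (inj₂ (refl , refl)) =
      consW-++-[] u v , inj₁ (trans (length-consW u []) (trans (⊔-identityʳ _) u≡K))
    consW-++-blocks {ws = ws} {vs} (inj₂ (refl , refl)) ws-block =
      map-++ _ ws vs , mapped ws-block
      where
      mapped : FullOrEnded _ ws vs → FullOrEnded _ (consW [] ws) (consW [] vs)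
      mapped (inj₁ ws≡K)         = inj₁ (trans (length-map _ ws) ws≡K)
      mapped (inj₂ (refl , refl)) = inj₂ (refl , refl)

  convW-++ : ∀ {B : Set} {K k} (f g : B → List A) (bs : Vec B k) → All (λ b → FullOrEnded K (f b) (g b)) bs →
             convW (Vec.map (λ b → f b ++ g b) bs) ≡ convW (Vec.map f bs) ++ convW (Vec.map g bs)
             × FullOrEnded K (convW (Vec.map f bs)) (convW (Vec.map g bs))
  convW-++ f g []       []         = refl , inj₂ (refl , refl)
  convW-++ f g (b ∷ bs) (fe ∷ fes) with convW-++ f g bs fes
  ... | ++≡ , rest = let ++≡′ , block = consW-++-blocks fe rest in
    trans (cong (consW (f b ++ g b)) ++≡) ++≡′ , block

  convW-ended : ∀ {B : Set} {k} (bs : Vec B k) → convW {A = A} (Vec.map (λ _ → []) bs) ≡ []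
  convW-ended []       = refl
  convW-ended (b ∷ bs) rewrite convW-ended bs = refl

  Staircase : ℕ → (ℕ → List A) → Set
  Staircase K blocks = ∀ ℓ → length (blocks ℓ) ≡ K ⊎ (∀ ℓ′ → ℓ ≤ ℓ′ → blocks ℓ′ ≡ [])

  convW-concat : ∀ {B : Set} {K k} (blocks : B → ℕ → List A) (bs : Vec B k) →
                 All (Staircase K ∘ blocks) bs → ∀ H →
                 convW (Vec.map (λ b → concat (applyUpTo (blocks b) H)) bs)
                 ≡ concat (applyUpTo (λ ℓ → convW (Vec.map (λ b → blocks b ℓ) bs)) H)
  convW-concat blocks bs stairs zero    = convW-ended bs
  convW-concat {K = K} blocks bs stairs (suc H) =
    trans (proj₁ (convW-++ (λ b → blocks b 0) (λ b → concat (applyUpTo (blocks b ∘ suc) H)) bs (first-block stairs)))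
          (cong (_ ++_) (convW-concat (λ b → blocks b ∘ suc) bs (shift stairs) H))
    where
    first-block : ∀ {k} {bs : Vec _ k} → All (Staircase K ∘ blocks) bs →
                  All (λ b → FullOrEnded K (blocks b 0) (concat (applyUpTo (blocks b ∘ suc) H))) bs
    first-block []              = []
    first-block (stair ∷ stairs) with stair 0
    ... | inj₁ full  = inj₁ full ∷ first-block stairs
    ... | inj₂ empty =
      inj₂ (empty 0 z≤n , concat-applyUpTo-[] _ H (λ ℓ → empty (suc ℓ) z≤n)) ∷ first-block stairs
    shift : ∀ {k} {bs : Vec _ k} → All (Staircase K ∘ blocks) bs → All (Staircase K ∘ (λ b → blocks b ∘ suc)) bs
    shift []               = []
    shift (stair ∷ stairs) =
      (λ ℓ → map₂ (λ empty ℓ′ ℓ≤ℓ′ → empty (suc ℓ′) (s≤s ℓ≤ℓ′)) (stair (suc ℓ))) ∷ shift stairs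

  heads-consW : ∀ {k} (u : List A) (ws : List (Vec (Maybe A) k)) →
                ∃[ d ] map head (consW u ws) ≡ map just u ++ replicate d nothing
  heads-consW []      ws       = length ws , trans (sym (map-∘ ws)) (heads-blank ws)
    where
    heads-blank : ∀ {k} (ws : List (Vec (Maybe A) k)) →
                  map (head ∘ (nothing ∷_)) ws ≡ replicate (length ws) nothing
    heads-blank []       = refl
    heads-blank (w ∷ ws) = cong (nothing ∷_) (heads-blank ws)
  heads-consW (x ∷ u) []       = let d , eq = heads-consW u [] in d , cong (just x ∷_) eq
  heads-consW (x ∷ u) (w ∷ ws) = let d , eq = heads-consW u ws in d , cong (just x ∷_) eq

  tails-consW : ∀ {k} (u : List A) (ws : List (Vec (Maybe A) k)) →
                ∃[ e ] map tail (consW u ws) ≡ ws ++ replicate e (blank k)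
  tails-consW []      ws       = 0 , trans (sym (map-∘ ws)) (trans (map-id ws) (sym (++-identityʳ ws)))
  tails-consW (x ∷ u) []       = let e , eq = tails-consW u [] in suc e , cong (blank _ ∷_) eq
  tails-consW (x ∷ u) (w ∷ ws) = let e , eq = tails-consW u ws in e , cong (w ∷_) eq

-- The encoding C, level by level

module _ {A : Set} where

  symbols : List (A × Bool) → List (Hat A)
  symbols = map (λ p → symbol (proj₁ p) (proj₂ p))

  padded : ℕ → List (A × Bool) → List (Hat A)
  padded K L = symbols L ++ replicate (K ∸ length L) dollar

  -- encLevel K t ℓ is padded K (levelNodes t ℓ); an empty level is encoded by nothing rather than K dollars.
  block : ℕ → List (A × Bool) → List (Hat A)
  block K []       = []
  block K (x ∷ L) = padded K (x ∷ L)

  block-nonempty : ∀ K L → L ≢ [] → block K L ≡ padded K L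
  block-nonempty K []      L≢[] = contradiction refl L≢[]
  block-nonempty K (x ∷ L) _    = refl

  length-padded : ∀ {K} L → length L ≤ K → length (padded K L) ≡ K
  length-padded {K} L L≤K = trans (length-++ (symbols L))
    (trans (cong₂ _+_ (length-map _ L) (length-replicate (K ∸ length L))) (m+[n∸m]≡n L≤K))

  length-block-≤ : ∀ {K} L → length L ≤ K → length (block K L) ≤ K
  length-block-≤ []      _   = z≤n
  length-block-≤ (x ∷ L) L≤K rewrite length-padded (x ∷ L) L≤K = ≤-refl

  private
    concat-applyUpTo-extend : ∀ {B : Set} (f g : ℕ → List B) a H → (∀ ℓ → ℓ < a → f ℓ ≡ g ℓ) →
      (∀ ℓ → a ≤ ℓ → g ℓ ≡ []) → a ≤ H → concat (applyUpTo f a) ≡ concat (applyUpTo g H)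
    concat-applyUpTo-extend f g zero    H       _     ended _ = sym (concat-applyUpTo-[] g H (λ ℓ → ended ℓ z≤n))
    concat-applyUpTo-extend f g (suc a) (suc H) agree ended (s≤s a≤H) =
      cong₂ _++_ (agree 0 (s≤s z≤n))
        (concat-applyUpTo-extend (f ∘ suc) (g ∘ suc) a H (λ ℓ ℓ<a → agree (suc ℓ) (s≤s ℓ<a))
                                 (λ ℓ a≤ℓ → ended (suc ℓ) (s≤s a≤ℓ)) a≤H)

  encode-blocks : ∀ K (t : Tree A) H → height t < H →
                  encode K t ≡ concat (applyUpTo (λ ℓ → block K (levelNodes t ℓ)) H)
  encode-blocks K t H h<H =
    trans (cong concat (map-upTo (encLevel K t) (suc (height t))))
          (concat-applyUpTo-extend _ _ (suc (height t)) H within beyond h<H)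
    where
    within : ∀ ℓ → ℓ < suc (height t) → encLevel K t ℓ ≡ block K (levelNodes t ℓ)
    within ℓ (s≤s ℓ≤h) = sym (block-nonempty K (levelNodes t ℓ) (levelNodes-within t ℓ ℓ≤h))
    beyond : ∀ ℓ → suc (height t) ≤ ℓ → block K (levelNodes t ℓ) ≡ []
    beyond ℓ h<ℓ = cong (block K) (levelNodes-beyond t ℓ h<ℓ)

  blocks-staircase : ∀ K (t : Tree A) → ThicknessAtMost K t → Staircase K (λ ℓ → block K (levelNodes t ℓ))
  blocks-staircase K t thin ℓ with ℓ ≤? height t
  ... | yes ℓ≤h = inj₁ (trans (cong length (block-nonempty K _ (levelNodes-within t ℓ ℓ≤h)))
                              (length-padded (levelNodes t ℓ) (levelNodes-thin K t thin ℓ)))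
  ... | no  ℓ≰h = inj₂ λ ℓ′ ℓ≤ℓ′ →
    cong (block K) (levelNodes-beyond t ℓ′ (<-≤-trans (≰⇒> ℓ≰h) ℓ≤ℓ′))

  encodeLevel : ∀ {k} → ℕ → Vec (List (A × Bool)) k → List (Vec (Maybe (Hat A)) k)
  encodeLevel K Z = convW (Vec.map (block K) Z)

  treeLevels : ∀ {k} → ℕ → Vec (Tree A) k → List (Vec (List (A × Bool)) k)
  treeLevels H ts = applyUpTo (λ ℓ → Vec.map (λ t → levelNodes t ℓ) ts) H

  convW-encode : ∀ K H {k} (ts : Vec (Tree A) k) → All (ThicknessAtMost K) ts → All (λ t → height t < H) ts →
                 convW (Vec.map (encode K) ts) ≡ concat (map (encodeLevel K) (treeLevels H ts))
  convW-encode K H ts thin below = begin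
    convW (Vec.map (encode K) ts)
      ≡⟨ cong convW (map-cong-All (All.map (λ {t} → encode-blocks K t H) below)) ⟩
    convW (Vec.map (λ t → concat (applyUpTo (blocks t) H)) ts)
      ≡⟨ convW-concat blocks ts (All.map (λ {t} → blocks-staircase K t) thin) H ⟩
    concat (applyUpTo (λ ℓ → convW (Vec.map (λ t → blocks t ℓ) ts)) H)
      ≡⟨ cong concat (sym (trans (map-applyUpTo _ (encodeLevel K) H)
                                 (applyUpTo-cong (λ ℓ → cong convW (sym (Vec.map-∘ (block K) _ ts))) H))) ⟩
    concat (map (encodeLevel K) (treeLevels H ts)) ∎
    where
    open ≡-Reasoning
    blocks : Tree A → ℕ → List (Hat A)
    blocks t ℓ = block K (levelNodes t ℓ)
    map-cong-All : ∀ {B C : Set} {k} {f g : B → C} {xs : Vec B k} →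
                   All (λ x → f x ≡ g x) xs → Vec.map f xs ≡ Vec.map g xs
    map-cong-All []         = refl
    map-cong-All (eq ∷ eqs) = cong₂ _∷_ eq (map-cong-All eqs)

  readSymbols : List (Maybe (Hat A)) → List (A × Bool)
  readSymbols (just (symbol a b) ∷ r) = (a , b) ∷ readSymbols r
  readSymbols _                        = []

  readLevel : ∀ {k} → List (Vec (Maybe (Hat A)) k) → Vec (List (A × Bool)) k
  readLevel {zero}  _ = []
  readLevel {suc k} w = readSymbols (map head w) ∷ readLevel (map tail w)

  private
    readSymbols-symbols : ∀ L R → readSymbols (map just (symbols L) ++ R) ≡ L ++ readSymbols R
    readSymbols-symbols []      R = refl
    readSymbols-symbols (x ∷ L) R = cong (x ∷_) (readSymbols-symbols L R)

    readSymbols-dollars : ∀ d R → readSymbols R ≡ [] → readSymbols (map just (replicate d dollar) ++ R) ≡ []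
    readSymbols-dollars zero    R ended = ended
    readSymbols-dollars (suc d) R _     = refl

    readSymbols-nothings : ∀ d c → readSymbols (replicate d nothing ++ replicate c nothing) ≡ []
    readSymbols-nothings zero    zero    = refl
    readSymbols-nothings zero    (suc c) = refl
    readSymbols-nothings (suc d) c       = refl

  readSymbols-block : ∀ K L R → readSymbols R ≡ [] → readSymbols (map just (block K L) ++ R) ≡ L
  readSymbols-block K []      R ended = ended
  readSymbols-block K (x ∷ L) R ended = begin
    readSymbols (map just (padded K (x ∷ L)) ++ R)
      ≡⟨ cong (λ w → readSymbols (w ++ R)) (map-++ just (symbols (x ∷ L)) _) ⟩
    readSymbols ((map just (symbols (x ∷ L)) ++ map just dollars) ++ R)
      ≡⟨ cong readSymbols (++-assoc (map just (symbols (x ∷ L))) _ R) ⟩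
    readSymbols (map just (symbols (x ∷ L)) ++ map just dollars ++ R)
      ≡⟨ readSymbols-symbols (x ∷ L) _ ⟩
    x ∷ L ++ readSymbols (map just dollars ++ R)
      ≡⟨ cong ((x ∷ L) ++_) (readSymbols-dollars _ R ended) ⟩
    x ∷ L ++ []
      ≡⟨ ++-identityʳ (x ∷ L) ⟩
    x ∷ L ∎
    where
    open ≡-Reasoning
    dollars = replicate (K ∸ length (x ∷ L)) dollar

  readLevel-padded : ∀ K {k} (Z : Vec (List (A × Bool)) k) c → readLevel (encodeLevel K Z ++ replicate c (blank k)) ≡ Z
  readLevel-padded K []      c = refl
  readLevel-padded K {suc k} (L ∷ Z) c
    with heads-consW (block K L) (encodeLevel K Z) | tails-consW (block K L) (encodeLevel K Z)
  ... | d , heads≡ | e , tails≡ =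
    cong₂ _∷_ head-column (trans (cong readLevel tail-columns) (readLevel-padded K Z (e + c)))
    where
    open ≡-Reasoning
    w = encodeLevel K (L ∷ Z)
    head-column : readSymbols (map head (w ++ replicate c (blank (suc k)))) ≡ L
    head-column = begin
      readSymbols (map head (w ++ replicate c (blank (suc k))))
        ≡⟨ cong readSymbols (map-++ head w _) ⟩
      readSymbols (map head w ++ map head (replicate c (blank (suc k))))
        ≡⟨ cong₂ (λ hs ns → readSymbols (hs ++ ns)) heads≡ (map-replicate head c (blank (suc k))) ⟩
      readSymbols ((map just (block K L) ++ replicate d nothing) ++ replicate c nothing)
        ≡⟨ cong readSymbols (++-assoc (map just (block K L)) _ _) ⟩
      readSymbols (map just (block K L) ++ replicate d nothing ++ replicate c nothing)
        ≡⟨ readSymbols-block K L _ (readSymbols-nothings d c) ⟩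
      L ∎
    tail-columns : map tail (w ++ replicate c (blank (suc k))) ≡ encodeLevel K Z ++ replicate (e + c) (blank k)
    tail-columns = begin
      map tail (w ++ replicate c (blank (suc k)))
        ≡⟨ map-++ tail w _ ⟩
      map tail w ++ map tail (replicate c (blank (suc k)))
        ≡⟨ cong₂ _++_ tails≡ (map-replicate tail c (blank (suc k))) ⟩
      (encodeLevel K Z ++ replicate e (blank k)) ++ replicate c (blank k)
        ≡⟨ ++-assoc (encodeLevel K Z) _ _ ⟩
      encodeLevel K Z ++ replicate e (blank k) ++ replicate c (blank k)
        ≡⟨ cong (encodeLevel K Z ++_) (replicate-++ e c (blank k)) ⟩
      encodeLevel K Z ++ replicate (e + c) (blank k) ∎

  readLevel-encodeLevel : ∀ K {k} (Z : Vec (List (A × Bool)) k) → readLevel (encodeLevel K Z) ≡ Z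
  readLevel-encodeLevel K Z = trans (cong readLevel (sym (++-identityʳ (encodeLevel K Z)))) (readLevel-padded K Z 0)

  length-encodeLevel : ∀ K ℓ {k} (ts : Vec (Tree A) k) → All (ThicknessAtMost K) ts → Any (λ t → ℓ ≤ height t) ts →
                       length (encodeLevel K (Vec.map (λ t → levelNodes t ℓ) ts)) ≡ K
  length-encodeLevel K ℓ ts thin reached =
    trans (cong (length ∘ convW) (sym (Vec.map-∘ (block K) (λ t → levelNodes t ℓ) ts)))
      (length-convW-≡ _
        (All.map⁺ (All.map (λ {t} thin-t → length-block-≤ (levelNodes t ℓ) (levelNodes-thin K t thin-t ℓ)) thin))
        (Any.map⁺ (Any.map (λ {t} (thin-t , ℓ≤h) → full t thin-t ℓ≤h) (thin-and-reached thin reached))))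
    where
    full : ∀ t → ThicknessAtMost K t → ℓ ≤ height t → length (block K (levelNodes t ℓ)) ≡ K
    full t thin-t ℓ≤h = trans (cong length (block-nonempty K _ (levelNodes-within t ℓ ℓ≤h)))
                              (length-padded (levelNodes t ℓ) (levelNodes-thin K t thin-t ℓ))
    thin-and-reached : ∀ {k} {ts : Vec (Tree A) k} → All (ThicknessAtMost K) ts → Any (λ t → ℓ ≤ height t) ts →
                       Any (λ t → ThicknessAtMost K t × ℓ ≤ height t) ts
    thin-and-reached (thin-t ∷ _)   (here ℓ≤h)  = here (thin-t , ℓ≤h)
    thin-and-reached (_ ∷ thin-ts) (there any) = there (thin-and-reached thin-ts any)

-- The level automaton

module _ {Γ : Set} (𝒜 : TreeAut Γ) where
  open TreeAut 𝒜

  -- An inner node lacking children (on malformed input) is evaluated as a leaf.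
  evalLevel : List (Γ × Bool) → List (Fin states) → List (Fin states)
  evalLevel []                 qs             = []
  evalLevel ((a , false) ∷ xs) qs             = δleaf a ∷ evalLevel xs qs
  evalLevel ((a , true)  ∷ xs) (ql ∷ qr ∷ qs) = δnode a ql qr ∷ evalLevel xs qs
  evalLevel ((a , true)  ∷ xs) _              = δleaf a ∷ evalLevel xs []

  length-evalLevel : ∀ xs qs → length (evalLevel xs qs) ≡ length xs
  length-evalLevel []                 qs             = refl
  length-evalLevel ((a , false) ∷ xs) qs             = cong suc (length-evalLevel xs qs)
  length-evalLevel ((a , true)  ∷ xs) (ql ∷ qr ∷ qs) = cong suc (length-evalLevel xs qs)
  length-evalLevel ((a , true)  ∷ xs) []             = cong suc (length-evalLevel xs [])
  length-evalLevel ((a , true)  ∷ xs) (_ ∷ [])       = cong suc (length-evalLevel xs [])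

  runT-level : ∀ F → map (runT 𝒜) F ≡ evalLevel (map info F) (map (runT 𝒜) (nextLevel F))
  runT-level []               = refl
  runT-level (leaf a ∷ F)     = cong (_ ∷_) (runT-level F)
  runT-level (node a l r ∷ F) = cong (_ ∷_) (runT-level F)

arity : Bool → ℕ
arity false = 0
arity true  = 2

childCount : ∀ {A : Set} → List (A × Bool) → ℕ
childCount []            = 0
childCount ((_ , b) ∷ L) = arity b + childCount L

pop : ∀ {B : Set} → Bool → List B → Maybe B × List B
pop false L       = nothing , L
pop true  []      = nothing , []
pop true  (x ∷ L) = just x , L

columns-ext : ∀ {B : Set} {k} (Zs Zs′ : List (Vec B (suc k))) →
              (∀ i → map (λ Z → lookup Z i) Zs ≡ map (λ Z → lookup Z i) Zs′) → Zs ≡ Zs′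
columns-ext []       []         _       = refl
columns-ext []       (_ ∷ _)    columns with columns zero
... | ()
columns-ext (_ ∷ _)  []         columns with columns zero
... | ()
columns-ext (Z ∷ Zs) (Z′ ∷ Zs′) columns =
  cong₂ _∷_ (Pointwise-≡⇒≡ (ext (λ i → List.∷-injectiveˡ (columns i))))
            (columns-ext Zs Zs′ (λ i → List.∷-injectiveʳ (columns i)))

count : ∀ {k} → Fin k → List (Vec Bool k) → ℕ
count i []       = 0
count i (p ∷ ps) = if lookup p i then suc (count i ps) else count i ps

module LevelAutomaton {X : Set} (K m : ℕ) (𝒜 : TreeAut (Vec (Maybe X) (suc m))) where
  open TreeAut 𝒜 using (final) renaming (states to S)

  W : ℕ
  W = suc m * K

  LevelTuple : Set
  LevelTuple = Vec (List (X × Bool)) (suc m)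

  Presence : Set
  Presence = Vec Bool (suc m)

  frontierCode : Code (List (Fin S)) (λ qs → length qs ≤ W)
  frontierCode = listCode (finCode S) W

  open Code frontierCode using () renaming (size to Q; toFin to index; fromFin to frontierAt; fromFin-toFin to frontierAt-index)

  Table : Set
  Table = Vec Bool Q

  table : (List (Fin S) → Bool) → Table
  table Φ = tabulate (Φ ∘ frontierAt)

  Represents : Table → (List (Fin S) → Bool) → Set
  Represents tbl Φ = ∀ qs → length qs ≤ W → lookup tbl (index qs) ≡ Φ qs

  table-represents : ∀ {Φ Ψ} → (∀ qs → length qs ≤ W → Φ qs ≡ Ψ qs) → Represents (table Φ) Ψ
  table-represents {Φ} Φ≗Ψ qs qs≤W =
    trans (Vec.lookup∘tabulate (Φ ∘ frontierAt) (index qs)) (trans (cong Φ (frontierAt-index qs≤W)) (Φ≗Ψ qs qs≤W))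

  popRows : List Presence → LevelTuple → List (Vec (Maybe (X × Bool)) (suc m))
  popRows []       Z = []
  popRows (p ∷ ps) Z =
    Vec.zipWith (λ b L → proj₁ (pop b L)) p Z ∷ popRows ps (Vec.zipWith (λ b L → proj₂ (pop b L)) p Z)

  -- Both children of a node of the convolution lie in exactly those trees in which that node is inner.
  childPresence : Vec (Maybe (X × Bool)) (suc m) → List Presence
  childPresence r = if rowInner r then Vec.map isInner r ∷ Vec.map isInner r ∷ [] else []

  nextPresence : List Presence → LevelTuple → List Presence
  nextPresence ps Z = concatMap childPresence (popRows ps Z)

  nextTable : List Presence → LevelTuple → Table → Table
  nextTable ps Z tbl = table (λ qs → lookup tbl (index (evalLevel 𝒜 (map rowNode (popRows ps Z)) qs)))

  Consistent : List Presence → LevelTuple → Set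
  Consistent ps Z = ∀ i → length (lookup Z i) ≡ count i ps × length (lookup Z i) ≤ K

  consistent? : ∀ ps Z → Dec (Consistent ps Z)
  consistent? ps Z = all? λ i → (length (lookup Z i) ≟ count i ps) ×-dec (length (lookup Z i) ≤? K)

  State : Set
  State = Maybe (List Presence × Table)

  advance : List Presence → Table → LevelTuple → State
  advance ps tbl Z with consistent? ps Z | length (nextPresence ps Z) ≤? W
  ... | yes _ | yes _ = just (nextPresence ps Z , nextTable ps Z tbl)
  ... | _     | _     = nothing

  step : State → LevelTuple → State
  step nothing           Z = nothing
  step (just (ps , tbl)) Z = advance ps tbl Z

  accepting : State → Bool
  accepting nothing           = false
  accepting (just (ps , tbl)) = null ps ∧ lookup tbl (index [])

  rootTable : List (Fin S) → Bool
  rootTable (q ∷ []) = final q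
  rootTable _        = false

  levelAutomaton : Automaton LevelTuple
  levelAutomaton = record
    { State = State ; start = just ([ Vec.replicate (suc m) true ] , table rootTable)
    ; step = step ; accepting = accepting }

  open Automaton levelAutomaton using (run; Accepts)

  levelAutomaton-coded : 1 ≤ K → FinitelyCoded levelAutomaton
  levelAutomaton-coded 1≤K = record
    { Invariant = Maybe.All Narrow
    ; code      = maybeCode (listCode (vecCode boolCode (suc m)) W ×-code vecCode boolCode Q)
    ; start-inv = Maybe.just (≤-trans 1≤K (m≤m+n K (m * K)) , tt)
    ; step-inv  = step-inv }
    where
    Narrow : Pred (List Presence × Table) _
    Narrow = (λ ps → length ps ≤ W) ⟨×⟩ U
    step-inv : ∀ {s} Z → Maybe.All Narrow s → Maybe.All Narrow (step s Z)
    step-inv Z Maybe.nothing = Maybe.nothing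
    step-inv {just (ps , tbl)} Z (Maybe.just _) with consistent? ps Z | length (nextPresence ps Z) ≤? W
    ... | yes _ | yes ≤W = Maybe.just (≤W , tt)
    ... | yes _ | no  _  = Maybe.nothing
    ... | no  _ | _      = Maybe.nothing

  run-rejected : ∀ Zs → run nothing Zs ≡ nothing
  run-rejected []       = refl
  run-rejected (Z ∷ Zs) = run-rejected Zs

  private
    count-++ : ∀ i (ps qs : List Presence) → count i (ps ++ qs) ≡ count i ps + count i qs
    count-++ i []       qs = refl
    count-++ i (p ∷ ps) qs with lookup p i
    ... | true  = cong suc (count-++ i ps qs)
    ... | false = count-++ i ps qs

    anyTrue-false : ∀ {k} (bs : Vec Bool k) i → anyTrue bs ≡ false → lookup bs i ≡ false
    anyTrue-false (false ∷ bs) zero    _    = refl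
    anyTrue-false (false ∷ bs) (suc i) none = anyTrue-false bs i none

    count-childPresence : ∀ i r → count i (childPresence r) ≡ arity (isInner (lookup r i))
    count-childPresence i r with rowInner r in inner
    ... | true  rewrite Vec.lookup-map i isInner r with isInner (lookup r i)
    ...   | true  = refl
    ...   | false = refl
    count-childPresence i r | false
      rewrite sym (Vec.lookup-map i isInner r) | anyTrue-false (Vec.map isInner r) i inner = refl

    count-pop : ∀ b (L : List (X × Bool)) c → (if b then suc c else c) ≡ length L →
                c ≡ length (proj₂ (pop b L))
                × arity (isInner (proj₁ (pop b L))) + childCount (proj₂ (pop b L)) ≡ childCount L
    count-pop false L       c len = len , refl
    count-pop true  (x ∷ L) c len = suc-injective len , refl

  count-nextPresence : ∀ i ps Z → count i ps ≡ length (lookup Z i) →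
                       count i (nextPresence ps Z) ≡ childCount (lookup Z i)
  count-nextPresence i [] Z len with lookup Z i
  ... | [] = refl
  count-nextPresence i (p ∷ ps) Z len
    with count-pop (lookup p i) (lookup Z i) (count i ps) len
  ... | len′ , arity+ = begin
    count i (childPresence r ++ nextPresence ps Z′)
      ≡⟨ count-++ i (childPresence r) _ ⟩
    count i (childPresence r) + count i (nextPresence ps Z′)
      ≡⟨ cong₂ _+_ (count-childPresence i r) (count-nextPresence i ps Z′ (trans len′ (sym (cong length rest-i)))) ⟩
    arity (isInner (lookup r i)) + childCount (lookup Z′ i)
      ≡⟨ cong₂ (λ (x : Maybe (X × Bool)) L → arity (isInner x) + childCount L) head-i rest-i ⟩
    arity (isInner (proj₁ (pop (lookup p i) (lookup Z i)))) + childCount (proj₂ (pop (lookup p i) (lookup Z i)))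
      ≡⟨ arity+ ⟩
    childCount (lookup Z i) ∎
    where
    open ≡-Reasoning
    r  = Vec.zipWith (λ b L → proj₁ (pop b L)) p Z
    Z′ = Vec.zipWith (λ b L → proj₂ (pop b L)) p Z
    head-i = Vec.lookup-zipWith (λ b L → proj₁ (pop b L)) i p Z
    rest-i = Vec.lookup-zipWith (λ b L → proj₂ (pop b L)) i p Z

  -- c lists the levels of a forest with k roots, each of at most K nodes.
  ForestLevels : ℕ → List (List (X × Bool)) → Set
  ForestLevels k []      = k ≡ 0
  ForestLevels k (L ∷ c) = length L ≡ k × length L ≤ K × ForestLevels (childCount L) c

  accepted-columns : ∀ ps tbl Zs → accepting (run (just (ps , tbl)) Zs) ≡ true →
                     ∀ i → ForestLevels (count i ps) (map (λ Z → lookup Z i) Zs)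
  accepted-columns []      tbl [] acc i = refl
  accepted-columns (_ ∷ _) tbl [] ()
  accepted-columns ps tbl (Z ∷ Zs) acc i with consistent? ps Z | length (nextPresence ps Z) ≤? W
  ... | yes consistent | yes _ =
    proj₁ (consistent i) , proj₂ (consistent i) ,
    subst (λ k → ForestLevels k _) (count-nextPresence i ps Z (sym (proj₁ (consistent i))))
          (accepted-columns (nextPresence ps Z) (nextTable ps Z tbl) Zs acc i)
  ... | yes _ | no _ rewrite run-rejected Zs = contradiction acc λ ()
  ... | no _  | _    rewrite run-rejected Zs = contradiction acc λ ()

  build : List (X × Bool) → List (Tree X) → List (Tree X)
  build []                F             = []
  build ((a , false) ∷ L) F             = leaf a ∷ build L F
  build ((a , true)  ∷ L) (l ∷ r ∷ F)  = node a l r ∷ build L F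
  build ((a , true)  ∷ L) _             = leaf a ∷ build L []

  build-correct : ∀ L F → length F ≡ childCount L → map info (build L F) ≡ L × nextLevel (build L F) ≡ F
  build-correct []                []          _   = refl , refl
  build-correct ((a , false) ∷ L) F           len =
    let infos≡ , next≡ = build-correct L F len in cong (_ ∷_) infos≡ , next≡
  build-correct ((a , true)  ∷ L) (l ∷ r ∷ F) len =
    let infos≡ , next≡ = build-correct L F (suc-injective (suc-injective len)) in
    cong (_ ∷_) infos≡ , cong (λ F′ → l ∷ r ∷ F′) next≡

  forest-of-levels : ∀ k c → ForestLevels k c →
    Σ[ F ∈ List (Tree X) ] length F ≡ k × applyUpTo (nodesAt F) (length c) ≡ c × nodesAt F (length c) ≡ [] ×
                           (∀ ℓ → length (nodesAt F ℓ) ≤ K)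
  forest-of-levels k []      refl = [] , refl , refl , refl , λ _ → z≤n
  forest-of-levels k (L ∷ c) (len , L≤K , rest) with forest-of-levels (childCount L) c rest
  ... | F′ , lenF′ , levels , ended , thin with build-correct L F′ lenF′
  ...   | infos≡ , next≡ =
    F , trans (trans (sym (length-map info F)) (cong length infos≡)) len , levels′ , ended′ , thin′
    where
    F = build L F′
    nodesAt-F : ∀ ℓ → nodesAt F (suc ℓ) ≡ nodesAt F′ ℓ
    nodesAt-F ℓ = trans (nodesAt-suc F ℓ) (cong (λ G → nodesAt G ℓ) next≡)
    levels′ : applyUpTo (nodesAt F) (suc (length c)) ≡ L ∷ c
    levels′ = cong₂ _∷_ (trans (nodesAt-zero F) infos≡) (trans (applyUpTo-cong nodesAt-F (length c)) levels)
    ended′ : nodesAt F (suc (length c)) ≡ []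
    ended′ = trans (nodesAt-F (length c)) ended
    thin′ : ∀ ℓ → length (nodesAt F ℓ) ≤ K
    thin′ zero    = subst (_≤ K) (sym (cong length (trans (nodesAt-zero F) infos≡))) L≤K
    thin′ (suc ℓ) = subst (_≤ K) (sym (cong length (nodesAt-F ℓ))) (thin ℓ)

  tree-of-levels : ∀ c → ForestLevels 1 c → Σ[ t ∈ Tree X ]
    ThicknessAtMost K t × height t < length c × applyUpTo (levelNodes t) (length c) ≡ c
  tree-of-levels c forest with forest-of-levels 1 c forest
  ... | t ∷ [] , _ , levels , ended , thin =
    t , (λ ℓ → subst (_≤ K) (sym (trans (levelCount≡length t ℓ) (cong length (sym (nodesAt-singleton t ℓ))))) (thin ℓ)) ,
    height-below t (length c) (trans (sym (nodesAt-singleton t (length c))) ended) ,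
    trans (applyUpTo-cong (λ ℓ → sym (nodesAt-singleton t ℓ)) (length c)) levels

  accepted-trees : ∀ Zs → Accepts Zs → Σ[ ts ∈ Vec (Tree X) (suc m) ]
    All (ThicknessAtMost K) ts × All (λ t → height t < length Zs) ts × Zs ≡ treeLevels (length Zs) ts
  accepted-trees Zs acc =
    ts , tabulate⁺ (proj₁ ∘ proj₂ ∘ tree) , tabulate⁺ (proj₁ ∘ proj₂ ∘ proj₂ ∘ tree) , columns-ext _ _ columns
    where
    H = length Zs
    input : Fin (suc m) → List (List (X × Bool))
    input i = map (λ Z → lookup Z i) Zs
    count-start : ∀ i → count i [ Vec.replicate (suc m) true ] ≡ 1
    count-start i rewrite Vec.lookup-replicate i true = refl
    tree : ∀ i → Σ[ t ∈ Tree X ] ThicknessAtMost K t × height t < H × applyUpTo (levelNodes t) H ≡ input i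
    tree i = subst (λ h → Σ[ t ∈ Tree X ] ThicknessAtMost K t × height t < h × applyUpTo (levelNodes t) h ≡ input i)
                   (length-map _ Zs)
                   (tree-of-levels (input i) (subst (λ k → ForestLevels k (input i)) (count-start i) (accepted-columns _ _ Zs acc i)))
    ts : Vec (Tree X) (suc m)
    ts = tabulate (proj₁ ∘ tree)
    columns : ∀ i → input i ≡ map (λ Z → lookup Z i) (treeLevels H ts)
    columns i = sym (begin
      map (λ Z → lookup Z i) (treeLevels H ts)
        ≡⟨ map-applyUpTo _ (λ Z → lookup Z i) H ⟩
      applyUpTo (λ ℓ → lookup (Vec.map (λ t → levelNodes t ℓ) ts) i) H
        ≡⟨ applyUpTo-cong (λ ℓ → trans (Vec.lookup-map i _ ts) (cong (λ t → levelNodes t ℓ) (Vec.lookup∘tabulate (proj₁ ∘ tree) i))) H ⟩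
      applyUpTo (levelNodes (proj₁ (tree i))) H
        ≡⟨ proj₂ (proj₂ (proj₂ (tree i))) ⟩
      input i ∎)
      where open ≡-Reasoning

  presence : Row X (suc m) → Presence
  presence = Vec.map is-just

  count-presence : ∀ i U → count i (map presence U) ≡ length (column i U)
  count-presence i []      = refl
  count-presence i (v ∷ U) rewrite Vec.lookup-map i is-just v with lookup v i
  ... | nothing = count-presence i U
  ... | just _  = cong suc (count-presence i U)

  frontierLevel : List (Row X (suc m)) → LevelTuple
  frontierLevel U = tabulate (λ i → nodesAt (column i U) 0)

  frontierLevel-lookup : ∀ U i → lookup (frontierLevel U) i ≡ map info (column i U)
  frontierLevel-lookup U i = trans (Vec.lookup∘tabulate (λ j → nodesAt (column j U) 0) i) (nodesAt-zero (column i U))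

  frontierLevels : ℕ → List (Row X (suc m)) → List LevelTuple
  frontierLevels H U = applyUpTo (λ ℓ → tabulate (λ i → nodesAt (column i U) ℓ)) H

  nodesAt-column-suc : ∀ i (U : List (Row X (suc m))) ℓ →
                       nodesAt (column i U) (suc ℓ) ≡ nodesAt (column i (nextRows U)) ℓ
  nodesAt-column-suc i U ℓ = trans (nodesAt-suc (column i U) ℓ) (cong (λ F → nodesAt F ℓ) (sym (column-nextRows i U)))

  frontierLevels-suc : ∀ H U → frontierLevels (suc H) U ≡ frontierLevel U ∷ frontierLevels H (nextRows U)
  frontierLevels-suc H U =
    cong (frontierLevel U ∷_) (applyUpTo-cong (λ ℓ → Vec.tabulate-cong λ i → nodesAt-column-suc i U ℓ) H)

  private
    pop-frontier : ∀ (x : Maybe (Tree X)) R → pop (is-just x) (map info (fromMaybe x) ++ R) ≡ (Maybe.map info x , R)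
    pop-frontier nothing  R = refl
    pop-frontier (just t) R = refl

  popRows-frontier : ∀ U (Z rest : LevelTuple) → (∀ i → lookup Z i ≡ map info (column i U) ++ lookup rest i) →
                     popRows (map presence U) Z ≡ map infos U
  popRows-frontier []      Z rest split = refl
  popRows-frontier (v ∷ U) Z rest split =
    cong₂ _∷_ (Pointwise-≡⇒≡ (ext λ i → trans (Vec.lookup-zipWith _ i (presence v) Z)
                                             (trans (cong proj₁ (popped i)) (sym (Vec.lookup-map i (Maybe.map info) v)))))
              (popRows-frontier U _ rest λ i → trans (Vec.lookup-zipWith _ i (presence v) Z) (cong proj₂ (popped i)))
    where
    popped : ∀ i → pop (lookup (presence v) i) (lookup Z i)
                   ≡ (Maybe.map info (lookup v i) , map info (column i U) ++ lookup rest i)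
    popped i = begin
      pop (lookup (presence v) i) (lookup Z i)
        ≡⟨ cong₂ pop (Vec.lookup-map i is-just v) (split i) ⟩
      pop (is-just (lookup v i)) (map info (fromMaybe (lookup v i) ++ column i U) ++ lookup rest i)
        ≡⟨ cong (λ L → pop (is-just (lookup v i)) (L ++ lookup rest i))
                (map-++ info (fromMaybe (lookup v i)) (column i U)) ⟩
      pop (is-just (lookup v i)) ((map info (fromMaybe (lookup v i)) ++ map info (column i U)) ++ lookup rest i)
        ≡⟨ cong (pop (is-just (lookup v i))) (++-assoc (map info (fromMaybe (lookup v i))) _ _) ⟩
      pop (is-just (lookup v i)) (map info (fromMaybe (lookup v i)) ++ map info (column i U) ++ lookup rest i)
        ≡⟨ pop-frontier (lookup v i) _ ⟩
      (Maybe.map info (lookup v i) , map info (column i U) ++ lookup rest i) ∎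
      where open ≡-Reasoning

  childPresence-infos : ∀ v → childPresence (infos v) ≡ map presence (childRows v)
  childPresence-infos v with rowInner (infos v)
  ... | false = refl
  ... | true  = cong₂ (λ pl pr → pl ∷ pr ∷ []) (entrywise left λ { nothing → refl ; (just (leaf _)) → refl
                                                                ; (just (node _ _ _)) → refl })
                                               (entrywise right λ { nothing → refl ; (just (leaf _)) → refl
                                                                  ; (just (node _ _ _)) → refl })
    where
    entrywise : ∀ (child : Maybe (Tree X) → Maybe (Tree X)) → (∀ x → isInner (Maybe.map info x) ≡ is-just (child x)) →
                Vec.map isInner (infos v) ≡ presence (Vec.map child v)
    entrywise child agree =
      trans (sym (Vec.map-∘ isInner (Maybe.map info) v)) (trans (Vec.map-cong agree v) (Vec.map-∘ is-just child v))

  nextPresence-frontier : ∀ U Z → popRows (map presence U) Z ≡ map infos U →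
                          nextPresence (map presence U) Z ≡ map presence (nextRows U)
  nextPresence-frontier U Z popped = begin
    concatMap childPresence (popRows (map presence U) Z) ≡⟨ cong (concatMap childPresence) popped ⟩
    concatMap childPresence (map infos U)               ≡⟨ concatMap-map childPresence infos U ⟩
    concatMap (childPresence ∘ infos) U                 ≡⟨ concatMap-cong childPresence-infos U ⟩
    concatMap (map presence ∘ childRows) U              ≡⟨ map-concatMap presence childRows U ⟨
    map presence (nextRows U)                           ∎
    where open ≡-Reasoning

  popRows-frontierLevel : ∀ U → popRows (map presence U) (frontierLevel U) ≡ map infos U
  popRows-frontierLevel U = popRows-frontier U (frontierLevel U) (Vec.replicate (suc m) [])
    λ i → trans (frontierLevel-lookup U i)
                (sym (trans (cong (map info (column i U) ++_) (Vec.lookup-replicate i [])) (++-identityʳ _)))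

  record GoodFrontier (H : ℕ) (U : List (Row X (suc m))) : Set where
    field
      present : List.All RowPresent U
      thin    : ∀ i ℓ → length (nodesAt (column i U) ℓ) ≤ K
      ended   : ∀ i → nodesAt (column i U) H ≡ []

  module _ {H U} (good : GoodFrontier H U) where
    open GoodFrontier good

    length-column : ∀ i → length (column i U) ≤ K
    length-column i = subst (_≤ K) (trans (cong length (nodesAt-zero (column i U))) (length-map info (column i U))) (thin i 0)

    frontier-width : length U ≤ W
    frontier-width = ≤-trans (length-≤-columns U present) (sum-≤ (λ i → length (column i U)) length-column)

    frontierLevel-consistent : Consistent (map presence U) (frontierLevel U)
    frontierLevel-consistent i =
      trans (cong length (frontierLevel-lookup U i)) (trans (length-map info (column i U)) (sym (count-presence i U))) ,
      subst (_≤ K) (sym (trans (cong length (frontierLevel-lookup U i)) (length-map info (column i U)))) (length-column i)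

  GoodFrontier-next : ∀ {H U} → GoodFrontier (suc H) U → GoodFrontier H (nextRows U)
  GoodFrontier-next {H} {U} good = record
    { present = nextRows-present U
    ; thin    = λ i ℓ → subst (λ L → length L ≤ K) (nodesAt-column-suc i U ℓ) (thin i (suc ℓ))
    ; ended   = λ i → trans (sym (nodesAt-column-suc i U H)) (ended i) }
    where open GoodFrontier good

  step-frontier : ∀ {H U} tbl Φ → GoodFrontier (suc H) U → Represents tbl Φ →
    Σ[ tbl′ ∈ Table ] step (just (map presence U , tbl)) (frontierLevel U) ≡ just (map presence (nextRows U) , tbl′)
                    × Represents tbl′ (Φ ∘ evalLevel 𝒜 (map (rowNode ∘ infos) U))
  step-frontier {H} {U} tbl Φ good rep
    with consistent? (map presence U) (frontierLevel U) | length (nextPresence (map presence U) (frontierLevel U)) ≤? W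
  ... | no ¬consistent | _      = contradiction (frontierLevel-consistent good) ¬consistent
  ... | yes _          | no ≰W  = contradiction next-width ≰W
    where
    next-width = subst (_≤ W) (cong length (sym (nextPresence-frontier U (frontierLevel U) (popRows-frontierLevel U))))
                   (≤-trans (≤-reflexive (length-map presence (nextRows U))) (frontier-width (GoodFrontier-next good)))
  ... | yes _          | yes _  =
    nextTable (map presence U) (frontierLevel U) tbl ,
    cong (λ ps → just (ps , nextTable (map presence U) (frontierLevel U) tbl))
         (nextPresence-frontier U (frontierLevel U) (popRows-frontierLevel U)) ,
    table-represents represents
    where
    represents : ∀ qs → length qs ≤ W →
                 lookup tbl (index (evalLevel 𝒜 (map rowNode (popRows (map presence U) (frontierLevel U))) qs))
                 ≡ Φ (evalLevel 𝒜 (map (rowNode ∘ infos) U) qs)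
    represents qs _ rewrite popRows-frontierLevel U | sym (map-∘ {g = rowNode} {f = infos} U) =
      rep _ (≤-trans (≤-reflexive (trans (length-evalLevel 𝒜 (map (rowNode ∘ infos) U) qs) (length-map (rowNode ∘ infos) U)))
                     (frontier-width good))

  simulate : ∀ H U F tbl Φ → GoodFrontier H U → Pointwise Convolves U F → Represents tbl Φ →
             accepting (run (just (map presence U , tbl)) (frontierLevels H U)) ≡ Φ (map (runT 𝒜) F)
  simulate zero U F tbl Φ good cv rep
    with rows-ended U (GoodFrontier.present good)
                      (λ i → map-empty (trans (sym (nodesAt-zero (column i U))) (GoodFrontier.ended good i)))
    where
    map-empty : ∀ {xs : List (Tree X)} → map info xs ≡ [] → xs ≡ []
    map-empty {[]} _ = refl
  ... | refl with cv
  ...   | [] = rep [] z≤n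
  simulate (suc H) U F tbl Φ good cv rep with step-frontier tbl Φ good rep
  ... | tbl′ , step≡ , rep′ = begin
    accepting (run (just (map presence U , tbl)) (frontierLevels (suc H) U))
      ≡⟨ cong (accepting ∘ run (just (map presence U , tbl))) (frontierLevels-suc H U) ⟩
    accepting (run (step (just (map presence U , tbl)) (frontierLevel U)) (frontierLevels H (nextRows U)))
      ≡⟨ cong (λ s → accepting (run s (frontierLevels H (nextRows U)))) step≡ ⟩
    accepting (run (just (map presence (nextRows U) , tbl′)) (frontierLevels H (nextRows U)))
      ≡⟨ simulate H (nextRows U) (nextLevel F) tbl′ _ (GoodFrontier-next good) (Convolves-nextLevel cv) rep′ ⟩
    Φ (evalLevel 𝒜 (map (rowNode ∘ infos) U) (map (runT 𝒜) (nextLevel F)))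
      ≡⟨ cong (λ xs → Φ (evalLevel 𝒜 xs (map (runT 𝒜) (nextLevel F)))) (sym (Convolves-infos cv)) ⟩
    Φ (evalLevel 𝒜 (map info F) (map (runT 𝒜) (nextLevel F)))
      ≡⟨ cong Φ (sym (runT-level 𝒜 F)) ⟩
    Φ (map (runT 𝒜) F) ∎
    where open ≡-Reasoning

  accepts-treeLevels : 1 ≤ K → ∀ H ts → All (ThicknessAtMost K) ts → All (λ t → height t < H) ts →
    accepting (run (Automaton.start levelAutomaton) (treeLevels H ts)) ≡ final (runT 𝒜 (convT ts))
  accepts-treeLevels 1≤K H ts thin below =
    subst₂ (λ ps Zs → accepting (run (just (ps , table rootTable)) Zs) ≡ final (runT 𝒜 (convT ts)))
           (cong [_] (all-present ts)) levels
           (simulate H U₀ [ convT ts ] (table rootTable) rootTable good (Convolves-convT ts ∷ [])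
                     (table-represents λ _ _ → refl))
    where
    U₀ = [ Vec.map just ts ]
    all-present : ∀ {k} (ts : Vec (Tree X) k) → Vec.map is-just (Vec.map just ts) ≡ Vec.replicate k true
    all-present []       = refl
    all-present (t ∷ ts) = cong (true ∷_) (all-present ts)
    column-U₀ : ∀ i ℓ → nodesAt (column i U₀) ℓ ≡ levelNodes (lookup ts i) ℓ
    column-U₀ i ℓ = trans (cong (λ F → nodesAt F ℓ) (trans (++-identityʳ _)
                                                          (cong fromMaybe (Vec.lookup-map i just ts))))
                          (nodesAt-singleton (lookup ts i) ℓ)
    levels : frontierLevels H U₀ ≡ treeLevels H ts
    levels = applyUpTo-cong (λ ℓ → Pointwise-≡⇒≡ (ext λ i →
      trans (Vec.lookup∘tabulate (λ j → nodesAt (column j U₀) ℓ) i)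
            (trans (column-U₀ i ℓ) (sym (Vec.lookup-map i (λ t → levelNodes t ℓ) ts))))) H
    good : GoodFrontier H U₀
    good = record
      { present = (zero , present-head ts) ∷ []
      ; thin    = λ i ℓ → subst (λ L → length L ≤ K) (sym (column-U₀ i ℓ)) (levelNodes-thin K (lookup ts i) (lookup⁺ thin i) ℓ)
      ; ended   = λ i → trans (column-U₀ i H) (levelNodes-beyond (lookup ts i) H (lookup⁺ below i)) }
      where
      present-head : ∀ {k} (ts : Vec (Tree X) (suc k)) → is-just (lookup (Vec.map just ts) zero) ≡ true
      present-head (t ∷ _) = refl

-- The word automaton

module _ {X : Set} where

  private
    hatToMaybe : Hat X → Maybe (X × Bool)
    hatToMaybe (symbol a b) = just (a , b)
    hatToMaybe dollar       = nothing

    maybeToHat : Maybe (X × Bool) → Hat X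
    maybeToHat (just (a , b)) = symbol a b
    maybeToHat nothing        = dollar

    maybeToHat-hatToMaybe : ∀ h → maybeToHat (hatToMaybe h) ≡ h
    maybeToHat-hatToMaybe (symbol a b) = refl
    maybeToHat-hatToMaybe dollar       = refl

  hatCode : Code X U → Code (Hat X) U
  hatCode c = weaken (retract (maybeCode (c ×-code boolCode)) hatToMaybe maybeToHat maybeToHat-hatToMaybe) total
    where
    total : ∀ {h} → U h → Maybe.All _ (hatToMaybe h)
    total {symbol a b} _ = Maybe.just (tt , tt)
    total {dollar}     _ = Maybe.nothing

  hat-≡-dec : DecidableEquality X → DecidableEquality (Hat X)
  hat-≡-dec _≟_ h h′ =
    map′ hatToMaybe-injective (cong hatToMaybe) (Maybe.≡-dec (Product.≡-dec _≟_ Bool._≟_) (hatToMaybe h) (hatToMaybe h′))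
    where
    hatToMaybe-injective : hatToMaybe h ≡ hatToMaybe h′ → h ≡ h′
    hatToMaybe-injective eq = trans (sym (maybeToHat-hatToMaybe h)) (trans (cong maybeToHat eq) (maybeToHat-hatToMaybe h′))

module _ (σ K m : ℕ) (1≤K : 1 ≤ K) (𝒜 : TreeAut (Vec (Maybe (Fin σ)) (suc m))) where
  open LevelAutomaton K m 𝒜

  Letter : Set
  Letter = Vec (Maybe (Hat (Fin σ))) (suc m)

  letterCode : Code Letter U
  letterCode = vecCode (weaken (maybeCode (hatCode (finCode σ))) total) (suc m)
    where
    total : ∀ {x} → U x → Maybe.All U x
    total {just _}  _ = Maybe.just tt
    total {nothing} _ = Maybe.nothing

  word-≡-dec : DecidableEquality (List Letter)
  word-≡-dec = List.≡-dec (Vec.≡-dec (Maybe.≡-dec (hat-≡-dec Fin._≟_)))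

  decodeLevel : List Letter → Maybe LevelTuple
  decodeLevel = checkedDecode word-≡-dec (encodeLevel K) readLevel

  wordAutomaton : Automaton Letter
  wordAutomaton = chunked K (decoding decodeLevel levelAutomaton)

  wordAutomaton-coded : FinitelyCoded wordAutomaton
  wordAutomaton-coded =
    chunked-coded K _ (decoding-coded decodeLevel levelAutomaton (levelAutomaton-coded 1≤K)) letterCode 1≤K

  wordDFA : DFA Letter
  wordDFA = toDFA wordAutomaton wordAutomaton-coded

  wordAutomaton-accepts : ∀ w → Automaton.Accepts wordAutomaton w ⇔
    (∃[ Zs ] List.All (λ b → length b ≡ K) (map (encodeLevel K) Zs) × concat (map (encodeLevel K) Zs) ≡ w
             × Automaton.Accepts levelAutomaton Zs)
  wordAutomaton-accepts w = mk⇔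
    (λ acc → let bs , full , concat≡ , accBs = Equivalence.to (chunked-accepts K _ 1≤K w) acc
                 Zs , map≡ , accZs = Equivalence.to (levels bs) accBs
             in Zs , subst (List.All _) (sym map≡) full , trans (cong concat map≡) concat≡ , accZs)
    (λ (Zs , full , concat≡ , accZs) → Equivalence.from (chunked-accepts K _ 1≤K w)
       (map (encodeLevel K) Zs , full , concat≡ , Equivalence.from (levels _) (Zs , refl , accZs)))
    where
    levels = decoding-accepts decodeLevel levelAutomaton (encodeLevel K)
               (checkedDecode-sound word-≡-dec (encodeLevel K) readLevel)
               (checkedDecode-complete word-≡-dec (encodeLevel K) readLevel (readLevel-encodeLevel K))

  module _ (R : Vec (Tree (Fin σ)) (suc m) → Set) (thinR : ∀ ts → R ts → All (ThicknessAtMost K) ts)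
           (recognises : Recognises 𝒜 (convLang R)) where

    wordAutomaton-sound : ∀ w → Automaton.Accepts wordAutomaton w → encConvLang K R w
    wordAutomaton-sound w acc with Equivalence.to (wordAutomaton-accepts w) acc
    ... | Zs , _ , concat≡ , accZs with accepted-trees Zs accZs
    ... | ts , thin , below , Zs≡
      with Equivalence.to (recognises (convT ts))
             (trans (sym (accepts-treeLevels 1≤K _ ts thin below)) (subst (Automaton.Accepts levelAutomaton) Zs≡ accZs))
    ... | ts′ , Rts′ , convT≡ with convT-injective ts′ ts convT≡
    ... | refl = ts , Rts′ , (begin
      convW (Vec.map (encode K) ts)                           ≡⟨ convW-encode K (length Zs) ts thin below ⟩
      concat (map (encodeLevel K) (treeLevels (length Zs) ts)) ≡⟨ cong (concat ∘ map (encodeLevel K)) (sym Zs≡) ⟩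
      concat (map (encodeLevel K) Zs)                          ≡⟨ concat≡ ⟩
      w                                                        ∎)
      where open ≡-Reasoning

    wordAutomaton-complete : ∀ w → encConvLang K R w → Automaton.Accepts wordAutomaton w
    wordAutomaton-complete w (ts , Rts , refl) = Equivalence.from (wordAutomaton-accepts _)
      (treeLevels H ts , full , sym (convW-encode K H ts thin below) ,
       trans (accepts-treeLevels 1≤K H ts thin below) (Equivalence.from (recognises (convT ts)) (ts , Rts , refl)))
      where
      thin = thinR ts Rts
      H = suc (maxHeight ts)
      below = All.map s≤s (height≤maxHeight ts)
      full : List.All (λ b → length b ≡ K) (map (encodeLevel K) (treeLevels H ts))
      full = subst (List.All (λ b → length b ≡ K)) (sym (map-applyUpTo (λ ℓ → Vec.map (λ t → levelNodes t ℓ) ts) (encodeLevel K) H))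
               (applyUpTo⁺₁ (encodeLevel K ∘ λ ℓ → Vec.map (λ t → levelNodes t ℓ) ts) H
                 λ { (s≤s ℓ≤max) → length-encodeLevel K _ ts thin (reaches-maxHeight _ ts ℓ≤max) })

    wordDFA-recognises : RecognisesW wordDFA (encConvLang K R)
    wordDFA-recognises w =
      mk⇔ (wordAutomaton-sound w ∘ Equivalence.to accepts) (Equivalence.from accepts ∘ wordAutomaton-complete w)
      where accepts = toDFA-accepts wordAutomaton wordAutomaton-coded w

proposition4p6 : (σ K m : ℕ) → 1 ≤ K →
    Σ[ f ∈ (TreeAut (Vec (Maybe (Fin σ)) (suc m)) → DFA (Vec (Maybe (Hat (Fin σ))) (suc m))) ]
      ((R : Vec (Tree (Fin σ)) (suc m) → Set) →
       (𝒜 : TreeAut (Vec (Maybe (Fin σ)) (suc m))) →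
       (∀ ts → R ts → All (ThicknessAtMost K) ts) →
       Recognises 𝒜 (convLang R) →
       RecognisesW (f 𝒜) (encConvLang K R))
proposition4p6 σ K m 1≤K = wordDFA σ K m 1≤K , λ R 𝒜 → wordDFA-recognises σ K m 1≤K 𝒜 R
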